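{- For $n\ge1$ let $L_n(x)=\sum_{k}L(n,k)x^k$ and $W_n(x)=\sum_k W(n,k)x^k$, and set $L_0(x)=W_0(x)=1$. Then $$\sum_{n\ge0}L_n(x)\frac{t^n}{n!}=\exp\Big(\sum_{n\ge0}W_n(x)\frac{t^{n+1}}{(n+1)!}\Big).$$
   Context: For a permutation $\sigma=\sigma_1\cdots\sigma_n$ of $[n]$: a left peak is an index $i$ with $1\le i\le n-1$ and $\sigma_{i-1}<\sigma_i>\sigma_{i+1}$, with $\sigma_0=0$; an exterior peak is an index $i$ with $1\le i\le n$ and $\sigma_{i-1}<\sigma_i>\sigma_{i+1}$, with $\sigma_0=\sigma_{n+1}=0$. $L(n,k)$ (resp. $W(n,k)$) is the number of permutations of $[n]$ with exactly $k$ left peaks (resp. exterior peaks). -}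

module Defs where

open import Data.Nat using (ℕ; zero; suc; _∸_; _<ᵇ_; _≡ᵇ_; _!)
open import Data.Nat.Properties using (_!≢0; _≟_)
open import Data.Bool using (Bool; true; false; if_then_else_; _∧_)
open import Data.Fin using (Fin; toℕ)
open import Data.List using (List; []; _∷_; [_]; _++_; map; concatMap; length; filterᵇ; allFin)
open import Data.Vec using (Vec; toList)
import Data.Vec as V
import Data.Nat as ℕ
open import Data.Integer using (+_)
open import Data.Rational using (ℚ; 0ℚ; 1ℚ; _+_; _*_; _/_)
open import Relation.Nullary using (does)
open import Data.List.Relation.Unary.Unique.DecPropositional _≟_ using (unique?)

allWords : (m n : ℕ) → List (Vec (Fin n) m)
allWords zero    n = [ V.[] ]
allWords (suc m) n = concatMap (λ i → map (i V.∷_) (allWords m n)) (allFin n)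

asWord : ∀ {m n} → Vec (Fin n) m → List ℕ
asWord v = map (λ i → suc (toℕ i)) (toList v)

-- The permutations of [n] in one-line notation σ₁⋯σₙ: the injective
-- words of length n over {1,…,n}.
perms : ℕ → List (List ℕ)
perms n = filterᵇ (λ w → does (unique? w)) (map asWord (allWords n n))

-- peaksFrom p w : with p the entry just before the word w, counts the
-- positions i of w having a successor in w such that
-- (previous entry) < wᵢ > w_{i+1}.
peaksFrom : ℕ → List ℕ → ℕ
peaksFrom p (x ∷ y ∷ rest) =
  (if (p <ᵇ x) ∧ (y <ᵇ x) then 1 else 0) ℕ.+ peaksFrom x (y ∷ rest)
peaksFrom p _ = 0

-- left peaks: i ∈ [1, n-1], σ_{i-1} < σᵢ > σ_{i+1}, σ₀ = 0
leftPeaks : List ℕ → ℕ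
leftPeaks w = peaksFrom 0 w

-- exterior peaks: i ∈ [1, n], σ_{i-1} < σᵢ > σ_{i+1}, σ₀ = σ_{n+1} = 0
exteriorPeaks : List ℕ → ℕ
exteriorPeaks w = peaksFrom 0 (w ++ [ 0 ])

countWith : (List ℕ → ℕ) → ℕ → ℕ → ℕ
countWith stat n k = length (filterᵇ (λ w → stat w ≡ᵇ k) (perms n))

L : ℕ → ℕ → ℕ
L n k = countWith leftPeaks n k

W : ℕ → ℕ → ℕ
W n k = countWith exteriorPeaks n k

Lcoef : ℕ → ℕ → ℕ
Lcoef zero    zero    = 1
Lcoef zero    (suc k) = 0
Lcoef (suc n) k       = L (suc n) k

Wcoef : ℕ → ℕ → ℕ
Wcoef zero    zero    = 1
Wcoef zero    (suc k) = 0
Wcoef (suc n) k       = W (suc n) k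

-- Formal power series in t with polynomial (in x) coefficients over ℚ,
-- represented by their coefficient arrays:  S n k = [tⁿ xᵏ] S.

Series : Set
Series = ℕ → ℕ → ℚ

sumTo : ℕ → (ℕ → ℚ) → ℚ
sumTo zero    f = f 0
sumTo (suc n) f = sumTo n f + f (suc n)

oneS : Series
oneS zero zero = 1ℚ
oneS _    _    = 0ℚ

_⊛_ : Series → Series → Series
(A ⊛ B) n k = sumTo n (λ i → sumTo k (λ j → A i j * B (n ∸ i) (k ∸ j)))

_^S_ : Series → ℕ → Series
F ^S zero  = oneS
F ^S suc m = F ⊛ (F ^S m)

-- exp F = Σ_{m ≥ 0} F^m / m!, for F with zero constant term in t.
-- Then F^m has t-order ≥ m, so [tⁿ xᵏ] exp F only receives
-- contributions from m ≤ n; the sum below is exactly that finite sum.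
expS : Series → Series
expS F n k = sumTo n (λ m → (F ^S m) n k * ((+ 1) / (m !)) {{m !≢0}})

Lgf : Series
Lgf n k = ((+ Lcoef n k) / (n !)) {{n !≢0}}

Wgf : Series
Wgf zero    k = 0ℚ
Wgf (suc n) k = ((+ Wcoef n k) / (suc n !)) {{suc n !≢0}}

-- A permutation of [n+1] splits at its entry 1 as σ = A 1 B, and since 1 is a valley the left peaks of σ are
-- the exterior peaks of A together with the left peaks of B. Hence L_{n+1} = Σᵢ C(n,i) Wᵢ L_{n-i}: the exponential
-- generating function of the Lₙ satisfies L′ = W L with L(0) = 1, where W = Σ Wₙ tⁿ/n! is the derivative of the
-- exponent on the right, so L is its exponential. Instead of standardising A and B, this splitting identity is
-- proved by checking that both sides obey the same recursion under insertion of a new maximum; that recursion rests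
-- on the insertion recurrences W(n+1,k) = 2k W(n,k) + (n+3-2k) W(n,k-1) and L(n+1,k) = (2k+1) L(n,k) + (n+2-2k) L(n,k-1).

module Submission where

open import Data.Bool using (Bool; true; false; T; if_then_else_; _∧_)
open import Data.Bool.Properties using (∧-zeroʳ)
open import Data.Empty using (⊥-elim)
open import Data.Fin using (Fin; toℕ; fromℕ<)
open import Data.Fin.Properties using (toℕ<n; toℕ-fromℕ<; toℕ-injective)
open import Data.List using (List; []; _∷_; [_]; _++_; map; length; concatMap; allFin; filterᵇ)
open import Data.List.Base using (InitLast; initLast; _∷ʳ′_)
open import Data.List.Properties using (length-map; length-++; map-++; map-∘; ++-assoc; ∷-injectiveˡ; ∷-injectiveʳ)
open import Data.List.Membership.Propositional using (_∈_; find)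
open import Data.List.Membership.Propositional.Properties
  using (∈-map⁺; ∈-map⁻; ∈-concatMap⁺; ∈-concatMap⁻; ∈-allFin; ∈-filter⁺; ∈-filter⁻; ∈-∃++; ∈-++⁻; ∈-++⁺ˡ; ∈-++⁺ʳ)
open import Data.List.Membership.Propositional.Properties.WithK using (unique∧set⇒bag)
open import Data.List.Relation.Binary.BagAndSetEquality using (∼bag⇒↭)
open import Data.List.Relation.Binary.Disjoint.Propositional using (Disjoint)
open import Data.List.Relation.Binary.Permutation.Propositional using (_↭_)
open import Data.List.Relation.Binary.Permutation.Propositional.Properties using (map⁺)
open import Data.List.Relation.Unary.All as All using (All; []; _∷_)
open import Data.List.Relation.Unary.All.Properties using (++⁺; ++⁻ˡ; ++⁻ʳ)
open import Data.List.Relation.Unary.AllPairs using ([]; _∷_)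
open import Data.List.Relation.Unary.Any as Any using (here; there)
open import Data.List.Relation.Unary.Unique.Propositional using (Unique)
import Data.List.Relation.Unary.Unique.Propositional.Properties as Unique
open import Data.Nat using (ℕ; zero; suc; _+_; _*_; _∸_; _≤_; _<_; z≤n; s≤s; _<ᵇ_; _≡ᵇ_; _!; NonZero)
open import Data.Nat.Combinatorics using (_C_; nCk+nC[k+1]≡[n+1]C[k+1]; k>n⇒nCk≡0; nCk≡n!/k![n-k]!; k![n∸k]!∣n!)
open import Data.Nat.DivMod using (m/n*n≡m)
open import Data.Nat.ListAction using (sum)
open import Data.Nat.ListAction.Properties using (sum-++; sum-↭)
open import Data.Nat.Properties
open import Data.Nat.Solver using (module +-*-Solver)
open import Algebra.Properties.CommutativeSemigroup *-commutativeSemigroup using (x∙yz≈y∙xz)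
open import Data.List.Membership.DecPropositional _≟_ using (_∈?_)
open import Data.List.Relation.Unary.Unique.DecPropositional _≟_ using (unique?)
open import Data.Product using (Σ; ∃; ∃₂; _×_; _,_; proj₁; proj₂)
open import Data.Rational using (ℚ; _/_; fromℚᵘ) renaming (_+_ to _+ℚ_; _*_ to _*ℚ_)
open import Data.Rational.Properties using (toℚᵘ-injective; fromℚᵘ-cong; toℚᵘ-homo-+; toℚᵘ-homo-*; toℚᵘ-fromℚᵘ; 0/n≡0)
open import Data.Rational.Unnormalised as ℚᵘ using (mkℚᵘ; *≡*)
import Data.Rational.Unnormalised.Properties as ℚᵘ
open import Data.Sum using (inj₁; inj₂)
open import Data.Unit using (⊤; tt)
open import Data.Vec using (Vec; toList) renaming ([] to []ᵛ; _∷_ to _∷ᵛ_)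
open import Data.Vec.Properties using (length-toList)
open import Function using (_∘_)
open import Function.Bundles using (mk⇔)
open import Relation.Nullary using (¬_; Dec; does; yes; no)
open import Relation.Nullary.Decidable using (T?)
open import Relation.Binary.PropositionalEquality hiding ([_])
open ≡-Reasoning
open +-*-Solver

open import Defs

-- Finite sums

sumToℕ : ℕ → (ℕ → ℕ) → ℕ
sumToℕ zero    f = f 0
sumToℕ (suc n) f = sumToℕ n f + f (suc n)

sumToℕ-cong : ∀ n {f g : ℕ → ℕ} → (∀ i → i ≤ n → f i ≡ g i) → sumToℕ n f ≡ sumToℕ n g
sumToℕ-cong zero    f≗g = f≗g 0 z≤n
sumToℕ-cong (suc n) f≗g =
  cong₂ _+_ (sumToℕ-cong n (λ i i≤n → f≗g i (m≤n⇒m≤1+n i≤n))) (f≗g (suc n) ≤-refl)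

sumToℕ-+ : ∀ n (f g : ℕ → ℕ) → sumToℕ n (λ i → f i + g i) ≡ sumToℕ n f + sumToℕ n g
sumToℕ-+ zero    f g = refl
sumToℕ-+ (suc n) f g = begin
  sumToℕ n (λ i → f i + g i) + (f (suc n) + g (suc n))
    ≡⟨ cong (_+ (f (suc n) + g (suc n))) (sumToℕ-+ n f g) ⟩
  sumToℕ n f + sumToℕ n g + (f (suc n) + g (suc n))
    ≡⟨ solve 4 (λ a b c d → a :+ b :+ (c :+ d) := a :+ c :+ (b :+ d)) refl
         (sumToℕ n f) (sumToℕ n g) (f (suc n)) (g (suc n)) ⟩
  sumToℕ n f + f (suc n) + (sumToℕ n g + g (suc n)) ∎

*-distribˡ-sumToℕ : ∀ n c (f : ℕ → ℕ) → c * sumToℕ n f ≡ sumToℕ n (λ i → c * f i)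
*-distribˡ-sumToℕ zero    c f = refl
*-distribˡ-sumToℕ (suc n) c f =
  trans (*-distribˡ-+ c (sumToℕ n f) _) (cong (_+ c * f (suc n)) (*-distribˡ-sumToℕ n c f))

sumToℕ-zero : ∀ n (f : ℕ → ℕ) → (∀ i → i ≤ n → f i ≡ 0) → sumToℕ n f ≡ 0
sumToℕ-zero zero    f f≗0 = f≗0 0 z≤n
sumToℕ-zero (suc n) f f≗0 =
  cong₂ _+_ (sumToℕ-zero n f (λ i i≤n → f≗0 i (m≤n⇒m≤1+n i≤n))) (f≗0 (suc n) ≤-refl)

sumToℕ-unfoldˡ : ∀ n (f : ℕ → ℕ) → sumToℕ (suc n) f ≡ f 0 + sumToℕ n (λ i → f (suc i))
sumToℕ-unfoldˡ zero    f = refl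
sumToℕ-unfoldˡ (suc n) f = trans (cong (_+ f (suc (suc n))) (sumToℕ-unfoldˡ n f)) (+-assoc (f 0) _ _)

sumToℕ-comm : ∀ n m (f : ℕ → ℕ → ℕ) →
  sumToℕ n (λ i → sumToℕ m (f i)) ≡ sumToℕ m (λ j → sumToℕ n (λ i → f i j))
sumToℕ-comm zero    m f = refl
sumToℕ-comm (suc n) m f =
  trans (cong (_+ sumToℕ m (f (suc n))) (sumToℕ-comm n m f)) (sym (sumToℕ-+ m _ (f (suc n))))

sumToℕ-reverse : ∀ n (f : ℕ → ℕ) → sumToℕ n f ≡ sumToℕ n (λ i → f (n ∸ i))
sumToℕ-reverse zero    f = refl
sumToℕ-reverse (suc n) f = begin
  sumToℕ (suc n) f                               ≡⟨ sumToℕ-unfoldˡ n f ⟩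
  f 0 + sumToℕ n (λ i → f (suc i))                ≡⟨ +-comm (f 0) _ ⟩
  sumToℕ n (λ i → f (suc i)) + f 0                ≡⟨ cong (_+ f 0) (sumToℕ-reverse n (λ i → f (suc i))) ⟩
  sumToℕ n (λ i → f (suc (n ∸ i))) + f 0
    ≡⟨ cong₂ _+_ (sumToℕ-cong n (λ i i≤n → cong f (sym (+-∸-assoc 1 i≤n)))) (cong f (sym (n∸n≡0 (suc n)))) ⟩
  sumToℕ (suc n) (λ i → f (suc n ∸ i))             ∎

private
  antidiagonal : ℕ → (ℕ → ℕ → ℕ) → ℕ
  antidiagonal n f = sumToℕ n (λ i → f i (n ∸ i))

  sumToℕ-triangle-step : ∀ n (f : ℕ → ℕ → ℕ) →
    sumToℕ (suc n) (λ i → sumToℕ (suc n ∸ i) (f i)) ≡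
    sumToℕ n (λ i → sumToℕ (n ∸ i) (f i)) + antidiagonal (suc n) f
  sumToℕ-triangle-step n f = begin
    sumToℕ n (λ i → sumToℕ (suc n ∸ i) (f i)) + sumToℕ (n ∸ n) (f (suc n))
      ≡⟨ cong₂ _+_ (sumToℕ-cong n (λ i i≤n → cong (λ t → sumToℕ t (f i)) (+-∸-assoc 1 i≤n)))
                   (cong (λ t → sumToℕ t (f (suc n))) (n∸n≡0 n)) ⟩
    sumToℕ n (λ i → sumToℕ (n ∸ i) (f i) + f i (suc (n ∸ i))) + f (suc n) 0
      ≡⟨ cong (_+ f (suc n) 0) (sumToℕ-+ n _ _) ⟩
    sumToℕ n (λ i → sumToℕ (n ∸ i) (f i)) + sumToℕ n (λ i → f i (suc (n ∸ i))) + f (suc n) 0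
      ≡⟨ +-assoc (sumToℕ n (λ i → sumToℕ (n ∸ i) (f i))) _ _ ⟩
    sumToℕ n (λ i → sumToℕ (n ∸ i) (f i)) + (sumToℕ n (λ i → f i (suc (n ∸ i))) + f (suc n) 0)
      ≡⟨ cong (λ t → sumToℕ n (λ i → sumToℕ (n ∸ i) (f i)) + t)
           (cong₂ _+_ (sumToℕ-cong n (λ i i≤n → cong (f i) (sym (+-∸-assoc 1 i≤n))))
                      (cong (f (suc n)) (sym (n∸n≡0 (suc n))))) ⟩
    sumToℕ n (λ i → sumToℕ (n ∸ i) (f i)) + antidiagonal (suc n) f ∎

  antidiagonal-flip : ∀ n (f : ℕ → ℕ → ℕ) → antidiagonal n f ≡ antidiagonal n (λ i j → f j i)
  antidiagonal-flip n f = trans (sumToℕ-reverse n (λ i → f i (n ∸ i)))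
    (sumToℕ-cong n (λ i i≤n → cong (f (n ∸ i)) (m∸[m∸n]≡n i≤n)))

sumToℕ-triangle-comm : ∀ n (f : ℕ → ℕ → ℕ) →
  sumToℕ n (λ i → sumToℕ (n ∸ i) (f i)) ≡ sumToℕ n (λ j → sumToℕ (n ∸ j) (λ i → f i j))
sumToℕ-triangle-comm zero    f = refl
sumToℕ-triangle-comm (suc n) f = begin
  sumToℕ (suc n) (λ i → sumToℕ (suc n ∸ i) (f i))
    ≡⟨ sumToℕ-triangle-step n f ⟩
  sumToℕ n (λ i → sumToℕ (n ∸ i) (f i)) + antidiagonal (suc n) f
    ≡⟨ cong₂ _+_ (sumToℕ-triangle-comm n f) (antidiagonal-flip (suc n) f) ⟩
  sumToℕ n (λ j → sumToℕ (n ∸ j) (λ i → f i j)) + antidiagonal (suc n) (λ i j → f j i)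
    ≡⟨ sym (sumToℕ-triangle-step n (λ i j → f j i)) ⟩
  sumToℕ (suc n) (λ j → sumToℕ (suc n ∸ j) (λ i → f i j)) ∎

≡ᵇ-refl : ∀ a → (a ≡ᵇ a) ≡ true
≡ᵇ-refl zero    = refl
≡ᵇ-refl (suc a) = ≡ᵇ-refl a

≢⇒≡ᵇ≡false : ∀ {a b} → a ≢ b → (a ≡ᵇ b) ≡ false
≢⇒≡ᵇ≡false {a} {b} a≢b with a ≡ᵇ b in eq
... | true  = ⊥-elim (a≢b (≡ᵇ⇒≡ a b (subst T (sym eq) tt)))
... | false = refl

𝟙 : Bool → ℕ
𝟙 b = if b then 1 else 0

δ : ℕ → ℕ → ℕ
δ a b = 𝟙 (a ≡ᵇ b)

δ-refl : ∀ a → δ a a ≡ 1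
δ-refl a = cong 𝟙 (≡ᵇ-refl a)

δ-≢ : ∀ {a b} → a ≢ b → δ a b ≡ 0
δ-≢ a≢b = cong 𝟙 (≢⇒≡ᵇ≡false a≢b)

δ-subst : ∀ a b (F : ℕ → ℕ) → δ a b * F a ≡ δ a b * F b
δ-subst a b F with a ≡ᵇ b in eq
... | true rewrite ≡ᵇ⇒≡ a b (subst T (sym eq) tt) = refl
... | false = refl

sumToℕ-δ-beyond : ∀ n p (F : ℕ → ℕ) → n < p → sumToℕ n (λ i → δ p i * F i) ≡ 0
sumToℕ-δ-beyond n p F n<p = sumToℕ-zero n _ (λ i i≤n →
  cong (_* F i) (δ-≢ (λ p≡i → <⇒≱ n<p (subst (_≤ n) (sym p≡i) i≤n))))

sumToℕ-δ : ∀ n p (F : ℕ → ℕ) → p ≤ n → sumToℕ n (λ i → δ p i * F i) ≡ F p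
sumToℕ-δ zero    zero    F _ = +-identityʳ (F 0)
sumToℕ-δ (suc n) p F p≤1+n with m≤n⇒m<n∨m≡n p≤1+n
... | inj₁ p<1+n rewrite δ-≢ (<⇒≢ p<1+n) =
  trans (+-identityʳ _) (sumToℕ-δ n p F (≤-pred p<1+n))
... | inj₂ refl rewrite δ-refl (suc n) =
  trans (cong (_+ (F (suc n) + 0)) (sumToℕ-δ-beyond n (suc n) F ≤-refl)) (+-identityʳ _)

sumToℕ-δ-antidiagonal : ∀ k b c → sumToℕ k (λ j → δ b j * δ c (k ∸ j)) ≡ δ (b + c) k
sumToℕ-δ-antidiagonal k b c with b ≤? k
... | yes b≤k = trans (sumToℕ-δ k b (λ j → δ c (k ∸ j)) b≤k) (shift b k b≤k)
  where
  shift : ∀ b k → b ≤ k → δ c (k ∸ b) ≡ δ (b + c) k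
  shift zero    k       _         = refl
  shift (suc b) (suc k) (s≤s b≤k) = shift b k b≤k
... | no b≰k = trans (sumToℕ-δ-beyond k b _ (≰⇒> b≰k))
  (sym (δ-≢ (λ b+c≡k → b≰k (subst (b ≤_) b+c≡k (m≤m+n b c)))))

-- Exponential generating functions

m∸n∸o≡m∸o∸n : ∀ m n o → m ∸ n ∸ o ≡ m ∸ o ∸ n
m∸n∸o≡m∸o∸n m n o = trans (∸-+-assoc m n o) (trans (cong (m ∸_) (+-comm n o)) (sym (∸-+-assoc m o n)))

C*factorials≡! : ∀ {n k} → k ≤ n → (n C k) * (k ! * (n ∸ k) !) ≡ n !
C*factorials≡! {n} {k} k≤n =
  trans (cong (_* (k ! * (n ∸ k) !)) (nCk≡n!/k![n-k]! k≤n))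
        (m/n*n≡m {{m*n≢0 (k !) ((n ∸ k) !) {{k !≢0}} {{(n ∸ k) !≢0}}}} (k![n∸k]!∣n! k≤n))

C*C-comm : ∀ {n i j} → i + j ≤ n → (n C i) * ((n ∸ i) C j) ≡ (n C j) * ((n ∸ j) C i)
C*C-comm {n} {i} {j} i+j≤n = *-cancelʳ-≡ _ _ (i ! * j ! * (n ∸ i ∸ j) !) {{nonZero}} (begin
  (n C i) * ((n ∸ i) C j) * (i ! * j ! * (n ∸ i ∸ j) !)  ≡⟨ multinomial i j i+j≤n ⟩
  n !                                                      ≡⟨ sym (multinomial j i (subst (_≤ n) (+-comm i j) i+j≤n)) ⟩
  (n C j) * ((n ∸ j) C i) * (j ! * i ! * (n ∸ j ∸ i) !)
    ≡⟨ cong₂ (λ a b → (n C j) * ((n ∸ j) C i) * (a * b !)) (*-comm (j !) (i !)) (m∸n∸o≡m∸o∸n n j i) ⟩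
  (n C j) * ((n ∸ j) C i) * (i ! * j ! * (n ∸ i ∸ j) !)  ∎)
  where
  nonZero : NonZero (i ! * j ! * (n ∸ i ∸ j) !)
  nonZero = m*n≢0 _ _ {{m*n≢0 _ _ {{i !≢0}} {{j !≢0}}}} {{(n ∸ i ∸ j) !≢0}}
  multinomial : ∀ a b → a + b ≤ n → (n C a) * ((n ∸ a) C b) * (a ! * b ! * (n ∸ a ∸ b) !) ≡ n !
  multinomial a b a+b≤n = begin
    (n C a) * ((n ∸ a) C b) * (a ! * b ! * (n ∸ a ∸ b) !)
      ≡⟨ solve 5 (λ x y p q r → x :* y :* (p :* q :* r) := x :* (p :* (y :* (q :* r)))) refl
           (n C a) ((n ∸ a) C b) (a !) (b !) ((n ∸ a ∸ b) !) ⟩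
    (n C a) * (a ! * (((n ∸ a) C b) * (b ! * (n ∸ a ∸ b) !)))
      ≡⟨ cong (λ t → (n C a) * (a ! * t)) (C*factorials≡! b≤n∸a) ⟩
    (n C a) * (a ! * (n ∸ a) !)
      ≡⟨ C*factorials≡! (≤-trans (m≤m+n a b) a+b≤n) ⟩
    n ! ∎
    where
    b≤n∸a : b ≤ n ∸ a
    b≤n∸a = subst (_≤ n ∸ a) (m+n∸m≡n a b) (∸-monoˡ-≤ a a+b≤n)

-- a n k is the coefficient of xᵏ tⁿ/n! in an exponential generating function in t.
Coeffs : Set
Coeffs = ℕ → ℕ → ℕ

𝟏 : Coeffs
𝟏 zero    zero    = 1
𝟏 zero    (suc k) = 0
𝟏 (suc n) k       = 0

∂ : Coeffs → Coeffs
∂ a n k = a (suc n) k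

∫ : Coeffs → Coeffs
∫ a zero    k = 0
∫ a (suc n) k = a n k

infixl 7 _⊙_

_⊙_ : Coeffs → Coeffs → Coeffs
(a ⊙ b) n k = sumToℕ n (λ i → (n C i) * sumToℕ k (λ j → a i j * b (n ∸ i) (k ∸ j)))

⊙-congʳ : ∀ a {b b′ : Coeffs} n k → (∀ p q → p ≤ n → q ≤ k → b p q ≡ b′ p q) → (a ⊙ b) n k ≡ (a ⊙ b′) n k
⊙-congʳ a n k b≗b′ = sumToℕ-cong n (λ i _ → cong ((n C i) *_) (sumToℕ-cong k (λ j _ →
  cong (a i j *_) (b≗b′ (n ∸ i) (k ∸ j) (m∸n≤m n i) (m∸n≤m k j)))))

⊙-*ʳ : ∀ a b s n k → (a ⊙ (λ p q → s * b p q)) n k ≡ s * (a ⊙ b) n k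
⊙-*ʳ a b s n k = begin
  sumToℕ n (λ i → (n C i) * sumToℕ k (λ j → a i j * (s * b (n ∸ i) (k ∸ j))))
    ≡⟨ sumToℕ-cong n (λ i _ → cong ((n C i) *_) (sumToℕ-cong k (λ j _ → x∙yz≈y∙xz (a i j) s _))) ⟩
  sumToℕ n (λ i → (n C i) * sumToℕ k (λ j → s * (a i j * b (n ∸ i) (k ∸ j))))
    ≡⟨ sumToℕ-cong n (λ i _ → trans (cong ((n C i) *_) (sym (*-distribˡ-sumToℕ k s _))) (x∙yz≈y∙xz (n C i) s _)) ⟩
  sumToℕ n (λ i → s * ((n C i) * sumToℕ k (λ j → a i j * b (n ∸ i) (k ∸ j))))
    ≡⟨ sym (*-distribˡ-sumToℕ n s _) ⟩
  s * (a ⊙ b) n k ∎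

⊙-sumToℕʳ : ∀ a (b : ℕ → Coeffs) M n k →
  (a ⊙ (λ p q → sumToℕ M (λ m → b m p q))) n k ≡ sumToℕ M (λ m → (a ⊙ b m) n k)
⊙-sumToℕʳ a b M n k = begin
  sumToℕ n (λ i → (n C i) * sumToℕ k (λ j → a i j * sumToℕ M (λ m → b m (n ∸ i) (k ∸ j))))
    ≡⟨ sumToℕ-cong n (λ i _ → cong ((n C i) *_) (trans (sumToℕ-cong k (λ j _ → *-distribˡ-sumToℕ M (a i j) _))
         (sumToℕ-comm k M _))) ⟩
  sumToℕ n (λ i → (n C i) * sumToℕ M (λ m → sumToℕ k (λ j → a i j * b m (n ∸ i) (k ∸ j))))
    ≡⟨ sumToℕ-cong n (λ i _ → *-distribˡ-sumToℕ M (n C i) _) ⟩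
  sumToℕ n (λ i → sumToℕ M (λ m → (n C i) * sumToℕ k (λ j → a i j * b m (n ∸ i) (k ∸ j))))
    ≡⟨ sumToℕ-comm n M _ ⟩
  sumToℕ M (λ m → (a ⊙ b m) n k) ∎

⊙-zeroʳ : ∀ a n k → (a ⊙ (λ _ _ → 0)) n k ≡ 0
⊙-zeroʳ a n k = sumToℕ-zero n _ (λ i _ →
  trans (cong ((n C i) *_) (sumToℕ-zero k _ (λ j _ → *-zeroʳ (a i j)))) (*-zeroʳ (n C i)))

⊙-zeroˡ-at-0 : ∀ a b k → (∀ j → a 0 j ≡ 0) → (a ⊙ b) 0 k ≡ 0
⊙-zeroˡ-at-0 a b k a₀≡0 = trans (+-identityʳ _) (sumToℕ-zero k _ (λ j _ → cong (_* b 0 (k ∸ j)) (a₀≡0 j)))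

⊙-leibniz : ∀ a b → (∀ j → a 0 j ≡ 0) → ∀ n k → ∂ (a ⊙ b) n k ≡ (∂ a ⊙ b) n k + (a ⊙ ∂ b) n k
⊙-leibniz a b a₀≡0 n k = begin
  sumToℕ (suc n) (λ i → (suc n C i) * S i (suc n ∸ i))
    ≡⟨ sumToℕ-unfoldˡ n _ ⟩
  1 * S 0 (suc n) + sumToℕ n (λ i → (suc n C suc i) * S (suc i) (n ∸ i))
    ≡⟨ cong₂ _+_ (cong (1 *_) (S₀≡0 (suc n)))
         (sumToℕ-cong n (λ i _ → trans (cong (_* S (suc i) (n ∸ i)) (sym (nCk+nC[k+1]≡[n+1]C[k+1] n i)))
                                         (*-distribʳ-+ _ (n C i) (n C suc i)))) ⟩
  0 + sumToℕ n (λ i → (n C i) * S (suc i) (n ∸ i) + (n C suc i) * S (suc i) (n ∸ i))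
    ≡⟨ sumToℕ-+ n _ _ ⟩
  (∂ a ⊙ b) n k + sumToℕ n (λ i → g (suc i))
    ≡⟨ cong ((∂ a ⊙ b) n k +_) shifted ⟩
  (∂ a ⊙ b) n k + (a ⊙ ∂ b) n k ∎
  where
  S : ℕ → ℕ → ℕ
  S i r = sumToℕ k (λ j → a i j * b r (k ∸ j))
  S₀≡0 : ∀ r → S 0 r ≡ 0
  S₀≡0 r = sumToℕ-zero k _ (λ j _ → cong (_* b r (k ∸ j)) (a₀≡0 j))
  g : ℕ → ℕ
  g i = (n C i) * S i (suc n ∸ i)
  shifted : sumToℕ n (λ i → g (suc i)) ≡ (a ⊙ ∂ b) n k
  shifted = begin
    sumToℕ n (λ i → g (suc i))        ≡⟨ cong (_+ sumToℕ n (λ i → g (suc i))) (sym (cong ((n C 0) *_) (S₀≡0 (suc n)))) ⟩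
    g 0 + sumToℕ n (λ i → g (suc i))  ≡⟨ sym (sumToℕ-unfoldˡ n g) ⟩
    sumToℕ n g + g (suc n)            ≡⟨ cong (λ c → sumToℕ n g + c * S (suc n) (n ∸ n)) (k>n⇒nCk≡0 (n<1+n n)) ⟩
    sumToℕ n g + 0                    ≡⟨ +-identityʳ _ ⟩
    sumToℕ n g                        ≡⟨ sumToℕ-cong n (λ i i≤n → cong (λ t → (n C i) * S i t) (+-∸-assoc 1 i≤n)) ⟩
    (a ⊙ ∂ b) n k                     ∎

private
  ⊙⊙-expanded : Coeffs → Coeffs → Coeffs → Coeffs
  ⊙⊙-expanded a b c n k = sumToℕ n (λ i → sumToℕ (n ∸ i) (λ i′ → sumToℕ k (λ j → sumToℕ (k ∸ j) (λ j′ →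
    ((n C i) * ((n ∸ i) C i′)) * (a i j * b i′ j′) * c (n ∸ i ∸ i′) (k ∸ j ∸ j′)))))

  ⊙⊙≡expanded : ∀ a b c n k → (a ⊙ (b ⊙ c)) n k ≡ ⊙⊙-expanded a b c n k
  ⊙⊙≡expanded a b c n k = sumToℕ-cong n (λ i _ → begin
    (n C i) * sumToℕ k (λ j → a i j * sumToℕ (n ∸ i) (λ i′ → ((n ∸ i) C i′) * sumToℕ (k ∸ j) (λ j′ → bc i j i′ j′)))
      ≡⟨ cong ((n C i) *_) (sumToℕ-cong k (λ j _ → trans (*-distribˡ-sumToℕ (n ∸ i) (a i j) _)
           (sumToℕ-cong (n ∸ i) (λ i′ _ → trans (x∙yz≈y∙xz (a i j) ((n ∸ i) C i′) _)
              (trans (cong (((n ∸ i) C i′) *_) (*-distribˡ-sumToℕ (k ∸ j) (a i j) _))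
                     (*-distribˡ-sumToℕ (k ∸ j) ((n ∸ i) C i′) _)))))) ⟩
    (n C i) * sumToℕ k (λ j → sumToℕ (n ∸ i) (λ i′ → sumToℕ (k ∸ j) (λ j′ → ((n ∸ i) C i′) * (a i j * bc i j i′ j′))))
      ≡⟨ cong ((n C i) *_) (sumToℕ-comm k (n ∸ i) _) ⟩
    (n C i) * sumToℕ (n ∸ i) (λ i′ → sumToℕ k (λ j → sumToℕ (k ∸ j) (λ j′ → ((n ∸ i) C i′) * (a i j * bc i j i′ j′))))
      ≡⟨ trans (*-distribˡ-sumToℕ (n ∸ i) (n C i) _) (sumToℕ-cong (n ∸ i) (λ i′ _ →
           trans (*-distribˡ-sumToℕ k (n C i) _) (sumToℕ-cong k (λ j _ →
             trans (*-distribˡ-sumToℕ (k ∸ j) (n C i) _) (sumToℕ-cong (k ∸ j) (λ j′ _ →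
               solve 5 (λ p q x y z → p :* (q :* (x :* (y :* z))) := (p :* q) :* (x :* y) :* z) refl
                 (n C i) ((n ∸ i) C i′) (a i j) (b i′ j′) (c (n ∸ i ∸ i′) (k ∸ j ∸ j′)))))))) ⟩
    sumToℕ (n ∸ i) (λ i′ → sumToℕ k (λ j → sumToℕ (k ∸ j) (λ j′ →
      ((n C i) * ((n ∸ i) C i′)) * (a i j * b i′ j′) * c (n ∸ i ∸ i′) (k ∸ j ∸ j′)))) ∎)
    where
    bc : ℕ → ℕ → ℕ → ℕ → ℕ
    bc i j i′ j′ = b i′ j′ * c (n ∸ i ∸ i′) (k ∸ j ∸ j′)

  expanded-comm : ∀ a b c n k → ⊙⊙-expanded a b c n k ≡ ⊙⊙-expanded b a c n k
  expanded-comm a b c n k = begin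
    ⊙⊙-expanded a b c n k
      ≡⟨ sumToℕ-triangle-comm n _ ⟩
    sumToℕ n (λ i′ → sumToℕ (n ∸ i′) (λ i → sumToℕ k (λ j → sumToℕ (k ∸ j) (λ j′ →
      ((n C i) * ((n ∸ i) C i′)) * (a i j * b i′ j′) * c (n ∸ i ∸ i′) (k ∸ j ∸ j′)))))
      ≡⟨ sumToℕ-cong n (λ i′ i′≤n → sumToℕ-cong (n ∸ i′) (λ i i≤n∸i′ → trans (sumToℕ-triangle-comm k _)
           (sumToℕ-cong k (λ j′ _ → sumToℕ-cong (k ∸ j′) (λ j _ → term-comm i i′ j j′ (i+i′≤n i′≤n i≤n∸i′)))))) ⟩
    ⊙⊙-expanded b a c n k ∎
    where
    i+i′≤n : ∀ {i i′} → i′ ≤ n → i ≤ n ∸ i′ → i + i′ ≤ n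
    i+i′≤n {i} {i′} i′≤n i≤n∸i′ = subst (_≤ n) (+-comm i′ i) (subst (i′ + i ≤_) (m+[n∸m]≡n i′≤n) (+-monoʳ-≤ i′ i≤n∸i′))
    term-comm : ∀ i i′ j j′ → i + i′ ≤ n →
      ((n C i) * ((n ∸ i) C i′)) * (a i j * b i′ j′) * c (n ∸ i ∸ i′) (k ∸ j ∸ j′) ≡
      ((n C i′) * ((n ∸ i′) C i)) * (b i′ j′ * a i j) * c (n ∸ i′ ∸ i) (k ∸ j′ ∸ j)
    term-comm i i′ j j′ i+i′≤n = cong₂ _*_ (cong₂ _*_ (C*C-comm {n} {i} {i′} i+i′≤n) (*-comm (a i j) (b i′ j′)))
                                           (cong₂ c (m∸n∸o≡m∸o∸n n i i′) (m∸n∸o≡m∸o∸n k j j′))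

⊙-left-comm : ∀ a b c n k → (a ⊙ (b ⊙ c)) n k ≡ (b ⊙ (a ⊙ c)) n k
⊙-left-comm a b c n k = begin
  (a ⊙ (b ⊙ c)) n k         ≡⟨ ⊙⊙≡expanded a b c n k ⟩
  ⊙⊙-expanded a b c n k     ≡⟨ expanded-comm a b c n k ⟩
  ⊙⊙-expanded b a c n k     ≡⟨ sym (⊙⊙≡expanded b a c n k) ⟩
  (b ⊙ (a ⊙ c)) n k         ∎

infixr 8 _^⊙_

_^⊙_ : Coeffs → ℕ → Coeffs
c ^⊙ zero  = 𝟏
c ^⊙ suc m = c ⊙ c ^⊙ m

module _ (c : Coeffs) (c₀≡0 : ∀ k → c 0 k ≡ 0) where

  -- cᵐ/m!, computed without division from ∂(cᵐ⁺¹/(m+1)!) = ∂c · cᵐ/m!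
  expTerm : ℕ → Coeffs
  expTerm zero            = 𝟏
  expTerm (suc m) zero    k = 0
  expTerm (suc m) (suc n) k = (∂ c ⊙ expTerm m) n k

  ⊙-expTerm : ∀ m n k → (c ⊙ expTerm m) n k ≡ suc m * expTerm (suc m) n k
  ⊙-expTerm m zero k = trans (⊙-zeroˡ-at-0 c (expTerm m) k c₀≡0) (sym (*-zeroʳ (suc m)))
  ⊙-expTerm zero (suc n) k = begin
    ∂ (c ⊙ 𝟏) n k                  ≡⟨ ⊙-leibniz c 𝟏 c₀≡0 n k ⟩
    (∂ c ⊙ 𝟏) n k + (c ⊙ ∂ 𝟏) n k  ≡⟨ cong ((∂ c ⊙ 𝟏) n k +_) (⊙-zeroʳ c n k) ⟩
    (∂ c ⊙ 𝟏) n k + 0              ≡⟨ +-identityʳ _ ⟩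
    (∂ c ⊙ 𝟏) n k                  ≡⟨ sym (*-identityˡ _) ⟩
    1 * expTerm 1 (suc n) k          ∎
  ⊙-expTerm (suc m) (suc n) k = begin
    ∂ (c ⊙ expTerm (suc m)) n k
      ≡⟨ ⊙-leibniz c (expTerm (suc m)) c₀≡0 n k ⟩
    expTerm (suc (suc m)) (suc n) k + (c ⊙ (∂ c ⊙ expTerm m)) n k
      ≡⟨ cong (expTerm (suc (suc m)) (suc n) k +_) (begin
           (c ⊙ (∂ c ⊙ expTerm m)) n k                       ≡⟨ ⊙-left-comm c (∂ c) (expTerm m) n k ⟩
           (∂ c ⊙ (c ⊙ expTerm m)) n k                       ≡⟨ ⊙-congʳ (∂ c) n k (λ p q _ _ → ⊙-expTerm m p q) ⟩
           (∂ c ⊙ (λ p q → suc m * expTerm (suc m) p q)) n k ≡⟨ ⊙-*ʳ (∂ c) (expTerm (suc m)) (suc m) n k ⟩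
           suc m * expTerm (suc (suc m)) (suc n) k           ∎) ⟩
    suc (suc m) * expTerm (suc (suc m)) (suc n) k ∎

  ^⊙≡!*expTerm : ∀ m n k → (c ^⊙ m) n k ≡ m ! * expTerm m n k
  ^⊙≡!*expTerm zero    n k = sym (+-identityʳ _)
  ^⊙≡!*expTerm (suc m) n k = begin
    (c ⊙ c ^⊙ m) n k                           ≡⟨ ⊙-congʳ c n k (λ p q _ _ → ^⊙≡!*expTerm m p q) ⟩
    (c ⊙ (λ p q → m ! * expTerm m p q)) n k    ≡⟨ ⊙-*ʳ c (expTerm m) (m !) n k ⟩
    m ! * (c ⊙ expTerm m) n k                   ≡⟨ cong (m ! *_) (⊙-expTerm m n k) ⟩
    m ! * (suc m * expTerm (suc m) n k)         ≡⟨ solve 3 (λ f s e → f :* (s :* e) := (s :* f) :* e) refl (m !) (suc m) _ ⟩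
    suc m ! * expTerm (suc m) n k               ∎

  -- Only the terms m ≤ n of Σₘ cᵐ/m! contribute to the coefficient of tⁿ.
  ∂≡∂c⊙⇒≡sum-expTerm : (a : Coeffs) → (∀ k → a 0 k ≡ 𝟏 0 k) → (∀ n k → ∂ a n k ≡ (∂ c ⊙ a) n k) →
                       ∀ M n k → n ≤ M → a n k ≡ sumToℕ M (λ m → expTerm m n k)
  ∂≡∂c⊙⇒≡sum-expTerm a a₀ ∂a zero    zero    k _ = a₀ k
  ∂≡∂c⊙⇒≡sum-expTerm a a₀ ∂a (suc M) zero    k _ = sym (begin
    sumToℕ (suc M) (λ m → expTerm m 0 k)            ≡⟨ sumToℕ-unfoldˡ M _ ⟩
    𝟏 0 k + sumToℕ M (λ m → expTerm (suc m) 0 k)   ≡⟨ cong (𝟏 0 k +_) (sumToℕ-zero M _ (λ _ _ → refl)) ⟩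
    𝟏 0 k + 0                                       ≡⟨ +-identityʳ _ ⟩
    𝟏 0 k                                           ≡⟨ sym (a₀ k) ⟩
    a 0 k                                           ∎)
  ∂≡∂c⊙⇒≡sum-expTerm a a₀ ∂a (suc M) (suc n) k (s≤s n≤M) = begin
    a (suc n) k                                      ≡⟨ ∂a n k ⟩
    (∂ c ⊙ a) n k                                    ≡⟨ ⊙-congʳ (∂ c) n k (λ p q p≤n _ →
                                                          ∂≡∂c⊙⇒≡sum-expTerm a a₀ ∂a M p q (≤-trans p≤n n≤M)) ⟩
    (∂ c ⊙ (λ p q → sumToℕ M (λ m → expTerm m p q))) n k ≡⟨ ⊙-sumToℕʳ (∂ c) expTerm M n k ⟩
    sumToℕ M (λ m → expTerm (suc m) (suc n) k)      ≡⟨ sym (sumToℕ-unfoldˡ M (λ m → expTerm m (suc n) k)) ⟩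
    sumToℕ (suc M) (λ m → expTerm m (suc n) k)      ∎

module _ where
  -- ℤ's prefix +_ is opened only here, since it makes sections such as (x +_) ambiguous.
  open import Data.Integer using (+_) renaming (_+_ to _+ℤ_; _*_ to _*ℤ_)
  import Data.Integer.Properties as ℤ

  infix 7.5 _÷_

  _÷_ : ℕ → (d : ℕ) .{{_ : NonZero d}} → ℚ
  a ÷ d = (+ a) / d

  infix 7.5 _÷!_

  _÷!_ : ℕ → ℕ → ℚ
  a ÷! n = (a ÷ n !) {{n !≢0}}

  private
    fromℚᵘ-homo-+ : ∀ p q → fromℚᵘ p +ℚ fromℚᵘ q ≡ fromℚᵘ (p ℚᵘ.+ q)
    fromℚᵘ-homo-+ p q = toℚᵘ-injective (ℚᵘ.≃-trans (toℚᵘ-homo-+ (fromℚᵘ p) (fromℚᵘ q))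
      (ℚᵘ.≃-trans (ℚᵘ.+-cong (toℚᵘ-fromℚᵘ p) (toℚᵘ-fromℚᵘ q)) (ℚᵘ.≃-sym (toℚᵘ-fromℚᵘ (p ℚᵘ.+ q)))))

    fromℚᵘ-homo-* : ∀ p q → fromℚᵘ p *ℚ fromℚᵘ q ≡ fromℚᵘ (p ℚᵘ.* q)
    fromℚᵘ-homo-* p q = toℚᵘ-injective (ℚᵘ.≃-trans (toℚᵘ-homo-* (fromℚᵘ p) (fromℚᵘ q))
      (ℚᵘ.≃-trans (ℚᵘ.*-cong (toℚᵘ-fromℚᵘ p) (toℚᵘ-fromℚᵘ q)) (ℚᵘ.≃-sym (toℚᵘ-fromℚᵘ (p ℚᵘ.* q)))))

  ÷-cross : ∀ a b d e .{{_ : NonZero d}} .{{_ : NonZero e}} → a * e ≡ b * d → a ÷ d ≡ b ÷ e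
  ÷-cross a b (suc d) (suc e) a*e≡b*d = fromℚᵘ-cong {mkℚᵘ (+ a) d} {mkℚᵘ (+ b) e}
    (*≡* (trans (sym (ℤ.pos-* a (suc e))) (trans (cong +_ a*e≡b*d) (ℤ.pos-* b (suc d)))))

  ÷-+ : ∀ a b d .{{_ : NonZero d}} → a ÷ d +ℚ b ÷ d ≡ (a + b) ÷ d
  ÷-+ a b (suc d) = begin
    a ÷ suc d +ℚ b ÷ suc d
      ≡⟨ fromℚᵘ-homo-+ (mkℚᵘ (+ a) d) (mkℚᵘ (+ b) d) ⟩
    fromℚᵘ (mkℚᵘ (+ a *ℤ + suc d +ℤ + b *ℤ + suc d) (d + d * suc d))
      ≡⟨ cong (λ z → fromℚᵘ (mkℚᵘ z (d + d * suc d))) numerator ⟩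
    (a * suc d + b * suc d) ÷ (suc d * suc d)
      ≡⟨ ÷-cross (a * suc d + b * suc d) (a + b) (suc d * suc d) (suc d)
           (trans (cong (_* suc d) (sym (*-distribʳ-+ (suc d) a b))) (*-assoc (a + b) (suc d) (suc d))) ⟩
    (a + b) ÷ suc d ∎
    where
    numerator : + a *ℤ + suc d +ℤ + b *ℤ + suc d ≡ + (a * suc d + b * suc d)
    numerator = trans (cong₂ _+ℤ_ (sym (ℤ.pos-* a (suc d))) (sym (ℤ.pos-* b (suc d))))
                      (sym (ℤ.pos-+ (a * suc d) (b * suc d)))

  ÷-* : ∀ a b d e .{{_ : NonZero d}} .{{_ : NonZero e}} → (a ÷ d) *ℚ (b ÷ e) ≡ ((a * b) ÷ (d * e)) {{m*n≢0 d e}}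
  ÷-* a b (suc d) (suc e) = trans (fromℚᵘ-homo-* (mkℚᵘ (+ a) d) (mkℚᵘ (+ b) e))
    (cong (λ z → fromℚᵘ (mkℚᵘ z (e + d * suc e))) (sym (ℤ.pos-* a b)))

sumTo-cong : ∀ n {f g : ℕ → ℚ} → (∀ i → i ≤ n → f i ≡ g i) → sumTo n f ≡ sumTo n g
sumTo-cong zero    f≗g = f≗g 0 z≤n
sumTo-cong (suc n) f≗g = cong₂ _+ℚ_ (sumTo-cong n (λ i i≤n → f≗g i (m≤n⇒m≤1+n i≤n))) (f≗g (suc n) ≤-refl)

sumTo-÷ : ∀ n (f : ℕ → ℕ) d .{{_ : NonZero d}} → sumTo n (λ i → f i ÷ d) ≡ sumToℕ n f ÷ d
sumTo-÷ zero    f d = refl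
sumTo-÷ (suc n) f d = trans (cong (_+ℚ f (suc n) ÷ d) (sumTo-÷ n f d)) (÷-+ (sumToℕ n f) (f (suc n)) d)

sumTo-÷! : ∀ n (f : ℕ → ℕ) d → sumTo n (λ i → f i ÷! d) ≡ sumToℕ n f ÷! d
sumTo-÷! n f d = sumTo-÷ n f (d !) {{d !≢0}}

egf : Coeffs → Series
egf a n k = a n k ÷! n

egf-𝟏 : ∀ n k → oneS n k ≡ egf 𝟏 n k
egf-𝟏 zero    zero    = refl
egf-𝟏 zero    (suc k) = sym (0/n≡0 1)
egf-𝟏 (suc n) k       = sym (0/n≡0 (suc n !) {{suc n !≢0}})

egf-⊛ : ∀ a b n k → (egf a ⊛ egf b) n k ≡ egf (a ⊙ b) n k
egf-⊛ a b n k = begin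
  sumTo n (λ i → sumTo k (λ j → egf a i j *ℚ egf b (n ∸ i) (k ∸ j)))
    ≡⟨ sumTo-cong n (λ i i≤n → sumTo-cong k (λ j _ → term i j i≤n)) ⟩
  sumTo n (λ i → sumTo k (λ j → ((n C i) * (a i j * b (n ∸ i) (k ∸ j))) ÷! n))
    ≡⟨ sumTo-cong n (λ i _ → sumTo-÷! k _ n) ⟩
  sumTo n (λ i → sumToℕ k (λ j → (n C i) * (a i j * b (n ∸ i) (k ∸ j))) ÷! n)
    ≡⟨ sumTo-÷! n _ n ⟩
  sumToℕ n (λ i → sumToℕ k (λ j → (n C i) * (a i j * b (n ∸ i) (k ∸ j)))) ÷! n
    ≡⟨ cong (λ z → z ÷! n) (sumToℕ-cong n (λ i _ → sym (*-distribˡ-sumToℕ k (n C i) _))) ⟩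
  egf (a ⊙ b) n k ∎
  where
  term : ∀ i j → i ≤ n → egf a i j *ℚ egf b (n ∸ i) (k ∸ j) ≡ ((n C i) * (a i j * b (n ∸ i) (k ∸ j))) ÷! n
  term i j i≤n = trans (÷-* (a i j) (b (n ∸ i) (k ∸ j)) (i !) ((n ∸ i) !) {{i !≢0}} {{(n ∸ i) !≢0}})
    (÷-cross ab ((n C i) * ab) (i ! * (n ∸ i) !) (n !) {{m*n≢0 (i !) ((n ∸ i) !) {{i !≢0}} {{(n ∸ i) !≢0}}}} {{n !≢0}}
      (trans (cong (ab *_) (sym (C*factorials≡! i≤n)))
             (solve 3 (λ x c f → x :* (c :* f) := (c :* x) :* f) refl ab (n C i) (i ! * (n ∸ i) !))))
    where ab = a i j * b (n ∸ i) (k ∸ j)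

egf-^S : ∀ (F : Series) c → (∀ n k → F n k ≡ egf c n k) → ∀ m n k → (F ^S m) n k ≡ egf (c ^⊙ m) n k
egf-^S F c F≗egf zero    n k = egf-𝟏 n k
egf-^S F c F≗egf (suc m) n k = trans
  (sumTo-cong n (λ i _ → sumTo-cong k (λ j _ → cong₂ _*ℚ_ (F≗egf i j) (egf-^S F c F≗egf m (n ∸ i) (k ∸ j)))))
  (egf-⊛ c (c ^⊙ m) n k)

egf≡expS : ∀ (F : Series) c a → (∀ n k → F n k ≡ egf c n k) → (∀ k → c 0 k ≡ 0) →
           (∀ k → a 0 k ≡ 𝟏 0 k) → (∀ n k → ∂ a n k ≡ (∂ c ⊙ a) n k) → ∀ n k → egf a n k ≡ expS F n k
egf≡expS F c a F≗egf c₀≡0 a₀ ∂a n k = sym (begin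
  sumTo n (λ m → (F ^S m) n k *ℚ 1 ÷! m)
    ≡⟨ sumTo-cong n (λ m _ → trans (cong (_*ℚ 1 ÷! m) (egf-^S F c F≗egf m n k)) (term m)) ⟩
  sumTo n (λ m → expTerm c c₀≡0 m n k ÷! n)
    ≡⟨ sumTo-÷! n _ n ⟩
  sumToℕ n (λ m → expTerm c c₀≡0 m n k) ÷! n
    ≡⟨ cong (_÷! n) (sym (∂≡∂c⊙⇒≡sum-expTerm c c₀≡0 a a₀ ∂a n n k ≤-refl)) ⟩
  egf a n k ∎)
  where
  term : ∀ m → egf (c ^⊙ m) n k *ℚ 1 ÷! m ≡ expTerm c c₀≡0 m n k ÷! n
  term m = trans (÷-* ((c ^⊙ m) n k) 1 (n !) (m !) {{n !≢0}} {{m !≢0}})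
    (÷-cross ((c ^⊙ m) n k * 1) (expTerm c c₀≡0 m n k) (n ! * m !) (n !) {{m*n≢0 (n !) (m !) {{n !≢0}} {{m !≢0}}}} {{n !≢0}}
      (trans (cong (λ z → z * 1 * n !) (^⊙≡!*expTerm c c₀≡0 m n k))
             (solve 3 (λ f e g → f :* e :* con 1 :* g := e :* (g :* f)) refl (m !) (expTerm c c₀≡0 m n k) (n !))))

-- Permutations as words

sumMap : {A : Set} → (A → ℕ) → List A → ℕ
sumMap f xs = sum (map f xs)

sumMap-map : {A B : Set} (f : B → ℕ) (g : A → B) (xs : List A) → sumMap f (map g xs) ≡ sumMap (λ x → f (g x)) xs
sumMap-map f g xs = cong sum (sym (map-∘ xs))

sumMap-++ : {A : Set} (f : A → ℕ) (xs ys : List A) → sumMap f (xs ++ ys) ≡ sumMap f xs + sumMap f ys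
sumMap-++ f xs ys = trans (cong sum (map-++ f xs ys)) (sum-++ (map f xs) (map f ys))

sumMap-↭ : {A : Set} (f : A → ℕ) {xs ys : List A} → xs ↭ ys → sumMap f xs ≡ sumMap f ys
sumMap-↭ f xs↭ys = sum-↭ (map⁺ f xs↭ys)

sumMap-concatMap : {A B : Set} (f : B → ℕ) (g : A → List B) (xs : List A) →
                   sumMap f (concatMap g xs) ≡ sumMap (λ x → sumMap f (g x)) xs
sumMap-concatMap f g []       = refl
sumMap-concatMap f g (x ∷ xs) = trans (sumMap-++ f (g x) (concatMap g xs)) (cong (sumMap f (g x) +_) (sumMap-concatMap f g xs))

sumMap-cong : {A : Set} {f g : A → ℕ} (xs : List A) → (∀ x → x ∈ xs → f x ≡ g x) → sumMap f xs ≡ sumMap g xs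
sumMap-cong []       f≗g = refl
sumMap-cong (x ∷ xs) f≗g = cong₂ _+_ (f≗g x (here refl)) (sumMap-cong xs (λ y y∈xs → f≗g y (there y∈xs)))

sumMap-+ : {A : Set} (f g : A → ℕ) (xs : List A) → sumMap (λ x → f x + g x) xs ≡ sumMap f xs + sumMap g xs
sumMap-+ f g []       = refl
sumMap-+ f g (x ∷ xs) = trans (cong (f x + g x +_) (sumMap-+ f g xs))
  (solve 4 (λ a b c d → a :+ b :+ (c :+ d) := a :+ c :+ (b :+ d)) refl (f x) (g x) (sumMap f xs) (sumMap g xs))

sumMap-*ˡ : {A : Set} (c : ℕ) (f : A → ℕ) (xs : List A) → sumMap (λ x → c * f x) xs ≡ c * sumMap f xs
sumMap-*ˡ c f []       = sym (*-zeroʳ c)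
sumMap-*ˡ c f (x ∷ xs) = trans (cong (c * f x +_) (sumMap-*ˡ c f xs)) (sym (*-distribˡ-+ c (f x) _))

sumMap-sumToℕ : {A : Set} (xs : List A) (n : ℕ) (F : A → ℕ → ℕ) →
                sumMap (λ x → sumToℕ n (F x)) xs ≡ sumToℕ n (λ i → sumMap (λ x → F x i) xs)
sumMap-sumToℕ xs zero    F = refl
sumMap-sumToℕ xs (suc n) F = trans (sumMap-+ (λ x → sumToℕ n (F x)) (λ x → F x (suc n)) xs)
  (cong (_+ sumMap (λ x → F x (suc n)) xs) (sumMap-sumToℕ xs n F))

length-filterᵇ : {A : Set} (p : A → Bool) (xs : List A) → length (filterᵇ p xs) ≡ sumMap (λ x → 𝟙 (p x)) xs
length-filterᵇ p []       = refl
length-filterᵇ p (x ∷ xs) with p x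
... | true  = cong suc (length-filterᵇ p xs)
... | false = length-filterᵇ p xs

InRange : ℕ → ℕ → Set
InRange n x = 0 < x × x ≤ n

IsPerm : ℕ → List ℕ → Set
IsPerm n w = length w ≡ n × All (InRange n) w × Unique w

private
  ∈-asWords⁻ : ∀ m n w → w ∈ map asWord (allWords m n) → length w ≡ m × All (InRange n) w
  ∈-asWords⁻ m n w w∈ with ∈-map⁻ asWord w∈
  ... | v , _ , refl = trans (length-map _ (toList v)) (length-toList v) , All.tabulate (inRange ∘ ∈-map⁻ _)
    where
    inRange : ∀ {x} → ∃ (λ i → i ∈ toList v × x ≡ suc (toℕ i)) → InRange n x
    inRange (i , _ , refl) = s≤s z≤n , toℕ<n i

  ∈-asWords⁺ : ∀ m n w → length w ≡ m → All (InRange n) w → Σ (Vec (Fin n) m) λ v → v ∈ allWords m n × asWord v ≡ w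
  ∈-asWords⁺ zero    n []      refl []                        = []ᵛ , here refl , refl
  ∈-asWords⁺ (suc m) n (x ∷ w) len ((s≤s z≤n , x≤n) ∷ w∈n) with ∈-asWords⁺ m n w (suc-injective len) w∈n
  ... | v , v∈ , refl = fromℕ< x≤n ∷ᵛ v ,
        ∈-concatMap⁺ (λ i → map (i ∷ᵛ_) (allWords m n)) (Any.map (λ { refl → ∈-map⁺ _ v∈ }) (∈-allFin (fromℕ< x≤n))) ,
        cong (_∷ asWord v) (cong suc (toℕ-fromℕ< x≤n))

  asWord-injective : ∀ {m n} {v v′ : Vec (Fin n) m} → asWord v ≡ asWord v′ → v ≡ v′
  asWord-injective {v = []ᵛ}    {[]ᵛ}    _  = refl
  asWord-injective {v = i ∷ᵛ v} {j ∷ᵛ v′} eq =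
    cong₂ _∷ᵛ_ (toℕ-injective (suc-injective (∷-injectiveˡ eq))) (asWord-injective (∷-injectiveʳ eq))

concatMap⁺-Unique : {A B : Set} (P : A → Set) (f : A → List B) (xs : List A) → Unique xs → All P xs →
  (∀ x → P x → Unique (f x)) → (∀ x y → P x → P y → x ≢ y → Disjoint (f x) (f y)) → Unique (concatMap f xs)
concatMap⁺-Unique P f []       _            _          _        _        = []
concatMap⁺-Unique P f (x ∷ xs) (x∉xs ∷ uxs) (px ∷ pxs) f-unique f-disjoint =
  Unique.++⁺ (f-unique x px) (concatMap⁺-Unique P f xs uxs pxs f-unique f-disjoint) disjoint
  where
  disjoint : Disjoint (f x) (concatMap f xs)
  disjoint (v∈fx , v∈rest) with find (∈-concatMap⁻ f v∈rest)
  ... | y , y∈xs , v∈fy = f-disjoint x y px (All.lookup pxs y∈xs) (All.lookup x∉xs y∈xs) (v∈fx , v∈fy)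

allWords-Unique : ∀ m n → Unique (allWords m n)
allWords-Unique zero    n = [] ∷ []
allWords-Unique (suc m) n = concatMap⁺-Unique (λ _ → ⊤) _ (allFin n) (Unique.allFin⁺ n) (All.tabulate (λ _ → tt))
  (λ i _ → Unique.map⁺ (λ { refl → refl }) (allWords-Unique m n))
  (λ i j _ _ i≢j (p , q) → i≢j (same-head (∈-map⁻ _ p) (∈-map⁻ _ q)))
  where
  same-head : ∀ {i j} {w : Vec (Fin n) (suc m)} →
              ∃ (λ v → v ∈ allWords m n × w ≡ i ∷ᵛ v) → ∃ (λ v → v ∈ allWords m n × w ≡ j ∷ᵛ v) → i ≡ j
  same-head (_ , _ , refl) (_ , _ , refl) = refl

perms-Unique : ∀ n → Unique (perms n)
perms-Unique n = Unique.filter⁺ (T? ∘ (λ w → does (unique? w))) (Unique.map⁺ asWord-injective (allWords-Unique n n))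

private
  T-does⇒ : {A : Set} (d : Dec A) → T (does d) → A
  T-does⇒ (yes a) _ = a

  ⇒T-does : {A : Set} (d : Dec A) → A → T (does d)
  ⇒T-does (yes a) _ = tt
  ⇒T-does (no ¬a) a = ⊥-elim (¬a a)

∈-perms⁻ : ∀ n w → w ∈ perms n → IsPerm n w
∈-perms⁻ n w w∈ with ∈-filter⁻ (T? ∘ (λ w → does (unique? w))) {xs = map asWord (allWords n n)} w∈
... | w∈words , unique with ∈-asWords⁻ n n w w∈words
... | len , inRange = len , inRange , T-does⇒ (unique? w) unique

∈-perms⁺ : ∀ n w → IsPerm n w → w ∈ perms n
∈-perms⁺ n w (len , inRange , unique) with ∈-asWords⁺ n n w len inRange
... | v , v∈ , refl = ∈-filter⁺ (T? ∘ (λ w → does (unique? w))) (∈-map⁺ asWord v∈) (⇒T-does (unique? w) unique)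

insertions : ℕ → List ℕ → List (List ℕ)
insertions m []      = [ [ m ] ]
insertions m (x ∷ u) = (m ∷ x ∷ u) ∷ map (x ∷_) (insertions m u)

∈-insertions⁺ : ∀ m A B → A ++ m ∷ B ∈ insertions m (A ++ B)
∈-insertions⁺ m []      []      = here refl
∈-insertions⁺ m []      (b ∷ B) = here refl
∈-insertions⁺ m (a ∷ A) B       = there (∈-map⁺ (a ∷_) (∈-insertions⁺ m A B))

∈-insertions⁻ : ∀ m u w → w ∈ insertions m u → ∃₂ λ A B → u ≡ A ++ B × w ≡ A ++ m ∷ B
∈-insertions⁻ m []      w (here refl) = [] , [] , refl , refl
∈-insertions⁻ m (x ∷ u) w (here refl) = [] , x ∷ u , refl , refl
∈-insertions⁻ m (x ∷ u) w (there w∈) with ∈-map⁻ (x ∷_) w∈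
... | w′ , w′∈ , refl with ∈-insertions⁻ m u w′ w′∈
... | A , B , refl , refl = x ∷ A , B , refl , refl

insertions-++ : ∀ m A x B →
  insertions m (A ++ x ∷ B) ≡ map (_++ x ∷ B) (insertions m A) ++ map ((A ++ [ x ]) ++_) (insertions m B)
insertions-++ m []      x B = refl
insertions-++ m (a ∷ A) x B = cong ((m ∷ a ∷ A ++ x ∷ B) ∷_) (begin
  map (a ∷_) (insertions m (A ++ x ∷ B))
    ≡⟨ cong (map (a ∷_)) (insertions-++ m A x B) ⟩
  map (a ∷_) (map (_++ x ∷ B) (insertions m A) ++ map ((A ++ [ x ]) ++_) (insertions m B))
    ≡⟨ map-++ (a ∷_) (map (_++ x ∷ B) (insertions m A)) _ ⟩
  map (a ∷_) (map (_++ x ∷ B) (insertions m A)) ++ map (a ∷_) (map ((A ++ [ x ]) ++_) (insertions m B))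
    ≡⟨ cong₂ _++_ (trans (sym (map-∘ (insertions m A))) (map-∘ (insertions m A))) (sym (map-∘ (insertions m B))) ⟩
  map (_++ x ∷ B) (map (a ∷_) (insertions m A)) ++ map ((a ∷ A ++ [ x ]) ++_) (insertions m B) ∎)

private
  delete : ℕ → List ℕ → List ℕ
  delete m []       = []
  delete m (x ∷ xs) = if m ≡ᵇ x then xs else x ∷ delete m xs

  delete-insertions : ∀ m u w → All (m ≢_) u → w ∈ insertions m u → delete m w ≡ u
  delete-insertions m []      w _ (here refl) rewrite ≡ᵇ-refl m = refl
  delete-insertions m (x ∷ u) w _ (here refl) rewrite ≡ᵇ-refl m = refl
  delete-insertions m (x ∷ u) w (m≢x ∷ m∉u) (there w∈) with ∈-map⁻ (x ∷_) w∈
  ... | w′ , w′∈ , refl rewrite ≢⇒≡ᵇ≡false m≢x = cong (x ∷_) (delete-insertions m u w′ m∉u w′∈)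

insertions-Unique : ∀ m u → All (m ≢_) u → Unique (insertions m u)
insertions-Unique m []      _           = [] ∷ []
insertions-Unique m (x ∷ u) (m≢x ∷ m∉u) =
  All.tabulate (λ w∈ → head-differs (∈-map⁻ (x ∷_) w∈)) ∷ Unique.map⁺ (λ { refl → refl }) (insertions-Unique m u m∉u)
  where
  head-differs : ∀ {w} → ∃ (λ w′ → w′ ∈ insertions m u × w ≡ x ∷ w′) → m ∷ x ∷ u ≢ w
  head-differs (_ , _ , refl) eq = m≢x (∷-injectiveˡ eq)

Unique-middle⁻ : ∀ (A : List ℕ) {m B} → Unique (A ++ m ∷ B) → All (m ≢_) (A ++ B) × Unique (A ++ B)
Unique-middle⁻ []      (m∉B ∷ uB) = m∉B , uB
Unique-middle⁻ (a ∷ A) {m} {B} (a∉ ∷ u) with Unique-middle⁻ A u | ++⁻ʳ A a∉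
... | m∉ , u′ | a≢m ∷ a∉B = (λ m≡a → a≢m (sym m≡a)) ∷ m∉ , ++⁺ (++⁻ˡ A a∉) a∉B ∷ u′

Unique-middle⁺ : ∀ (A : List ℕ) {m B} → All (m ≢_) (A ++ B) → Unique (A ++ B) → Unique (A ++ m ∷ B)
Unique-middle⁺ []      m∉  u         = m∉ ∷ u
Unique-middle⁺ (a ∷ A) (m≢a ∷ m∉) (a∉ ∷ u) =
  ++⁺ (++⁻ˡ A a∉) ((λ a≡m → m≢a (sym a≡m)) ∷ ++⁻ʳ A a∉) ∷ Unique-middle⁺ A m∉ u

All-middle⁻ : ∀ {P : ℕ → Set} (A : List ℕ) {m B} → All P (A ++ m ∷ B) → P m × All P (A ++ B)
All-middle⁻ A all with ++⁻ʳ A all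
... | pm ∷ pB = pm , ++⁺ (++⁻ˡ A all) pB

All-middle⁺ : ∀ {P : ℕ → Set} (A : List ℕ) {m B} → P m → All P (A ++ B) → All P (A ++ m ∷ B)
All-middle⁺ A pm all = ++⁺ (++⁻ˡ A all) (pm ∷ ++⁻ʳ A all)

length-middle : ∀ (A : List ℕ) {m : ℕ} {B} → length (A ++ m ∷ B) ≡ suc (length (A ++ B))
length-middle []      = refl
length-middle (a ∷ A) = cong suc (length-middle A)

private
  InRange-pred : ∀ {n x} → InRange (suc n) x → suc n ≢ x → InRange n x
  InRange-pred (0<x , x≤1+n) 1+n≢x = 0<x , ≤-pred (≤∧≢⇒< x≤1+n (λ x≡1+n → 1+n≢x (sym x≡1+n)))

  All-InRange-pred : ∀ {n w} → ¬ (suc n ∈ w) → All (InRange (suc n)) w → All (InRange n) w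
  All-InRange-pred {n} {w} 1+n∉w inRange = All.tabulate (λ {x} x∈w →
    InRange-pred (All.lookup inRange x∈w) (λ 1+n≡x → 1+n∉w (subst (_∈ w) (sym 1+n≡x) x∈w)))

  Unique⇒length≤ : ∀ n w → Unique w → All (InRange n) w → length w ≤ n
  Unique⇒length≤ zero    []      _ _                 = z≤n
  Unique⇒length≤ zero    (x ∷ w) _ ((0<x , x≤0) ∷ _) = ⊥-elim (<-irrefl refl (≤-trans 0<x x≤0))
  Unique⇒length≤ (suc n) w u inRange with suc n ∈? w
  ... | no  1+n∉w = m≤n⇒m≤1+n (Unique⇒length≤ n w u (All-InRange-pred 1+n∉w inRange))
  ... | yes 1+n∈w with ∈-∃++ 1+n∈w
  ...   | A , B , refl = subst (_≤ suc n) (sym (length-middle A)) (s≤s (Unique⇒length≤ n (A ++ B) (proj₂ u′)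
          (All.zipWith (λ (r , ne) → InRange-pred r ne) (proj₂ (All-middle⁻ A inRange) , proj₁ u′))))
    where u′ = Unique-middle⁻ A u

  max∈perm : ∀ n w → IsPerm (suc n) w → suc n ∈ w
  max∈perm n w (len , inRange , u) with suc n ∈? w
  ... | yes 1+n∈w = 1+n∈w
  ... | no  1+n∉w = ⊥-elim (<-irrefl refl (subst (_≤ n) len (Unique⇒length≤ n w u (All-InRange-pred 1+n∉w inRange))))

  max∉perm : ∀ n τ → IsPerm n τ → All (suc n ≢_) τ
  max∉perm n τ (_ , inRange , _) = All.map (λ (_ , x≤n) 1+n≡x → <-irrefl refl (subst (_≤ n) (sym 1+n≡x) x≤n)) inRange

perm-suc-split : ∀ n w → w ∈ perms (suc n) → ∃₂ λ A B → w ≡ A ++ suc n ∷ B × A ++ B ∈ perms n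
perm-suc-split n w w∈ with ∈-∃++ (max∈perm n w (∈-perms⁻ (suc n) w w∈))
... | A , B , refl with ∈-perms⁻ (suc n) (A ++ suc n ∷ B) w∈
...   | len , inRange , u = A , B , refl , ∈-perms⁺ n (A ++ B)
  (suc-injective (trans (sym (length-middle A)) len) ,
   All.zipWith (λ (r , ne) → InRange-pred r ne) (proj₂ (All-middle⁻ A inRange) , proj₁ (Unique-middle⁻ A u)) ,
   proj₂ (Unique-middle⁻ A u))

private
  perms-suc⊆ : ∀ n w → w ∈ perms (suc n) → w ∈ concatMap (insertions (suc n)) (perms n)
  perms-suc⊆ n w w∈ with perm-suc-split n w w∈
  ... | A , B , refl , A++B∈ = ∈-concatMap⁺ (insertions (suc n)) (Any.map (λ { refl → ∈-insertions⁺ (suc n) A B }) A++B∈)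

  perms-suc⊇ : ∀ n w → w ∈ concatMap (insertions (suc n)) (perms n) → w ∈ perms (suc n)
  perms-suc⊇ n w w∈ with find (∈-concatMap⁻ (insertions (suc n)) w∈)
  ... | τ , τ∈ , w∈ins with ∈-perms⁻ n τ τ∈ | ∈-insertions⁻ (suc n) τ w w∈ins
  ... | isPerm@(len , inRange , u) | A , B , refl , refl = ∈-perms⁺ (suc n) (A ++ suc n ∷ B)
        (trans (length-middle A) (cong suc len) ,
         All-middle⁺ A (s≤s z≤n , ≤-refl) (All.map (λ (0<x , x≤n) → 0<x , m≤n⇒m≤1+n x≤n) inRange) ,
         Unique-middle⁺ A (max∉perm n (A ++ B) isPerm) u)

  insertions-perms-Unique : ∀ n → Unique (concatMap (insertions (suc n)) (perms n))
  insertions-perms-Unique n = concatMap⁺-Unique (All (suc n ≢_)) (insertions (suc n)) (perms n) (perms-Unique n)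
    (All.tabulate (λ {τ} τ∈ → max∉perm n τ (∈-perms⁻ n τ τ∈)))
    (insertions-Unique (suc n))
    (λ x y 1+n∉x 1+n∉y x≢y (w∈x , w∈y) →
      x≢y (trans (sym (delete-insertions (suc n) x _ 1+n∉x w∈x)) (delete-insertions (suc n) y _ 1+n∉y w∈y)))

perms-suc↭ : ∀ n → perms (suc n) ↭ concatMap (insertions (suc n)) (perms n)
perms-suc↭ n = ∼bag⇒↭ (unique∧set⇒bag (perms-Unique (suc n)) (insertions-perms-Unique n)
  (mk⇔ (perms-suc⊆ n _) (perms-suc⊇ n _)))

sumMap-perms-suc : ∀ n (f : List ℕ → ℕ) → sumMap f (perms (suc n)) ≡ sumMap (λ τ → sumMap f (insertions (suc n) τ)) (perms n)
sumMap-perms-suc n f = trans (sumMap-↭ f (perms-suc↭ n)) (sumMap-concatMap f (insertions (suc n)) (perms n))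

-- Peaks under insertion of a maximum

private
  <⇒<ᵇ≡true : ∀ {a b} → a < b → (a <ᵇ b) ≡ true
  <⇒<ᵇ≡true {a} {b} a<b with a <ᵇ b | <⇒<ᵇ a<b
  ... | true | _ = refl

  ≤⇒<ᵇ≡false : ∀ {a b} → b ≤ a → (a <ᵇ b) ≡ false
  ≤⇒<ᵇ≡false {a} {b} b≤a with a <ᵇ b | <ᵇ⇒< a b
  ... | false | _   = refl
  ... | true  | a<b = ⊥-elim (<⇒≱ (a<b tt) b≤a)

isPeakAfter : ℕ → ℕ → List ℕ → Bool
isPeakAfter p x []      = false
isPeakAfter p x (y ∷ _) = (p <ᵇ x) ∧ (y <ᵇ x)

headIsPeakAfter : ℕ → List ℕ → Bool
headIsPeakAfter p []      = false
headIsPeakAfter p (x ∷ s) = isPeakAfter p x s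

peaksFrom-∷ : ∀ p x s → peaksFrom p (x ∷ s) ≡ 𝟙 (isPeakAfter p x s) + peaksFrom x s
peaksFrom-∷ p x []      = refl
peaksFrom-∷ p x (y ∷ s) = refl

isPeakAfter⇒¬headIsPeakAfter : ∀ p x s → isPeakAfter p x s ≡ true → headIsPeakAfter x s ≡ false
isPeakAfter⇒¬headIsPeakAfter p x []          _ = refl
isPeakAfter⇒¬headIsPeakAfter p x (y ∷ [])    _ = refl
isPeakAfter⇒¬headIsPeakAfter p x (y ∷ z ∷ s) _ with p <ᵇ x | y <ᵇ x in y<ᵇx
isPeakAfter⇒¬headIsPeakAfter p x (y ∷ z ∷ s) () | false | _
isPeakAfter⇒¬headIsPeakAfter p x (y ∷ z ∷ s) () | true  | false
... | true | true rewrite ≤⇒<ᵇ≡false (<⇒≤ (<ᵇ⇒< y x (subst T (sym y<ᵇx) tt))) = refl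

shiftBy : Bool → (ℕ → ℕ) → ℕ → ℕ
shiftBy false g t       = g t
shiftBy true  g zero    = 0
shiftBy true  g (suc t) = g t

-- g t counts α objects with b peaks and β objects with b + 1 peaks.
Counts : (ℕ → ℕ) → ℕ → ℕ → ℕ → Set
Counts g b α β = ∀ t → g t ≡ δ b t * α + δ (suc b) t * β

private
  δ+δ*α≡δ*sucα : ∀ b t α → δ b t + δ b t * α ≡ δ b t * suc α
  δ+δ*α≡δ*sucα b t α = sym (*-suc (δ b t) α)

  tail-step : ∀ (x-peak next-peak : Bool) (b₁ v α₁ β₁ n : ℕ) (g : ℕ → ℕ) →
    (x-peak ≡ true → next-peak ≡ false) → v + 𝟙 next-peak ≡ suc b₁ → α₁ + 𝟙 next-peak ≡ 2 * b₁ →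
    α₁ + β₁ ≡ n → Counts g b₁ α₁ β₁ →
    Σ ℕ λ α → Σ ℕ λ β → α + 𝟙 x-peak ≡ 2 * (𝟙 x-peak + b₁) × α + β ≡ suc n ×
      Counts (λ t → δ v t + shiftBy x-peak g t) (𝟙 x-peak + b₁) α β
  tail-step true true _ _ _ _ _ _ excl _ _ _ _ with () ← excl refl
  tail-step true false b₁ v α₁ β₁ n g _ v≡ α₁≡ α₁+β₁ counts =
    suc α₁ , β₁ , α≡ , cong suc α₁+β₁ , counts′
    where
    v≡1+b₁ : v ≡ suc b₁
    v≡1+b₁ = trans (sym (+-identityʳ v)) v≡
    α≡ : suc α₁ + 1 ≡ 2 * (1 + b₁)
    α≡ = trans (+-comm (suc α₁) 1) (trans (cong (2 +_) (trans (sym (+-identityʳ α₁)) α₁≡)) (sym (*-distribˡ-+ 2 1 b₁)))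
    counts′ : Counts (λ t → δ v t + shiftBy true g t) (suc b₁) (suc α₁) β₁
    counts′ zero    rewrite v≡1+b₁ = refl
    counts′ (suc t) rewrite v≡1+b₁ | counts t =
      trans (sym (+-assoc (δ b₁ t) _ _)) (cong (_+ δ (suc b₁) t * β₁) (δ+δ*α≡δ*sucα b₁ t α₁))
  tail-step false true b₁ v α₁ β₁ n g _ v≡ α₁≡ α₁+β₁ counts =
    suc α₁ , β₁ , trans (+-identityʳ _) (trans (+-comm 1 α₁) α₁≡) , cong suc α₁+β₁ , counts′
    where
    counts′ : Counts (λ t → δ v t + g t) b₁ (suc α₁) β₁
    counts′ t rewrite suc-injective (trans (+-comm 1 v) v≡) | counts t =
      trans (sym (+-assoc (δ b₁ t) _ _)) (cong (_+ δ (suc b₁) t * β₁) (δ+δ*α≡δ*sucα b₁ t α₁))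
  tail-step false false b₁ v α₁ β₁ n g _ v≡ α₁≡ α₁+β₁ counts =
    α₁ , suc β₁ , α₁≡ , trans (+-suc α₁ β₁) (cong suc α₁+β₁) , counts′
    where
    counts′ : Counts (λ t → δ v t + g t) b₁ α₁ (suc β₁)
    counts′ t rewrite trans (sym (+-identityʳ v)) v≡ | counts t = begin
      δ (suc b₁) t + (δ b₁ t * α₁ + δ (suc b₁) t * β₁)  ≡⟨ +-comm (δ (suc b₁) t) _ ⟩
      δ b₁ t * α₁ + δ (suc b₁) t * β₁ + δ (suc b₁) t    ≡⟨ +-assoc (δ b₁ t * α₁) _ _ ⟩
      δ b₁ t * α₁ + (δ (suc b₁) t * β₁ + δ (suc b₁) t)  ≡⟨ cong (δ b₁ t * α₁ +_) (+-comm _ (δ (suc b₁) t)) ⟩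
      δ b₁ t * α₁ + (δ (suc b₁) t + δ (suc b₁) t * β₁)  ≡⟨ cong (δ b₁ t * α₁ +_) (δ+δ*α≡δ*sucα (suc b₁) t β₁) ⟩
      δ b₁ t * α₁ + δ (suc b₁) t * suc β₁               ∎

  front+tail : ∀ (head-peak : Bool) (b v α β n : ℕ) → v + 𝟙 head-peak ≡ suc b → α + 𝟙 head-peak ≡ 2 * b →
    α + β ≡ n → Counts (λ t → δ v t + (δ b t * α + δ (suc b) t * β)) b (2 * b) (suc n ∸ 2 * b)
  front+tail true b v α β n v≡ α≡ α+β t = begin
    δ v t + (δ b t * α + δ (suc b) t * β)   ≡⟨ cong (λ z → δ z t + (δ b t * α + δ (suc b) t * β)) v≡b ⟩
    δ b t + (δ b t * α + δ (suc b) t * β)   ≡⟨ sym (+-assoc (δ b t) _ _) ⟩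
    δ b t + δ b t * α + δ (suc b) t * β     ≡⟨ cong (_+ δ (suc b) t * β) (δ+δ*α≡δ*sucα b t α) ⟩
    δ b t * suc α + δ (suc b) t * β         ≡⟨ cong₂ (λ z w → δ b t * z + δ (suc b) t * w) 1+α≡2b (sym β≡) ⟩
    δ b t * (2 * b) + δ (suc b) t * (suc n ∸ 2 * b) ∎
    where
    v≡b : v ≡ b
    v≡b = suc-injective (trans (+-comm 1 v) v≡)
    1+α≡2b : suc α ≡ 2 * b
    1+α≡2b = trans (+-comm 1 α) α≡
    β≡ : suc n ∸ 2 * b ≡ β
    β≡ = trans (cong (suc n ∸_) (sym 1+α≡2b)) (trans (cong (_∸ α) (sym α+β)) (m+n∸m≡n α β))
  front+tail false b v α β n v≡ α≡ α+β t = begin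
    δ v t + (δ b t * α + δ (suc b) t * β)         ≡⟨ cong (λ z → δ z t + (δ b t * α + δ (suc b) t * β)) v≡1+b ⟩
    δ (suc b) t + (δ b t * α + δ (suc b) t * β)   ≡⟨ trans (+-comm (δ (suc b) t) _) (+-assoc (δ b t * α) _ _) ⟩
    δ b t * α + (δ (suc b) t * β + δ (suc b) t)   ≡⟨ cong (δ b t * α +_) (trans (+-comm _ (δ (suc b) t)) (δ+δ*α≡δ*sucα (suc b) t β)) ⟩
    δ b t * α + δ (suc b) t * suc β               ≡⟨ cong₂ (λ z w → δ b t * z + δ (suc b) t * w) α≡2b (sym β≡) ⟩
    δ b t * (2 * b) + δ (suc b) t * (suc n ∸ 2 * b) ∎
    where
    v≡1+b : v ≡ suc b
    v≡1+b = trans (sym (+-identityʳ v)) v≡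
    α≡2b : α ≡ 2 * b
    α≡2b = trans (sym (+-identityʳ α)) α≡
    β≡ : suc n ∸ 2 * b ≡ suc β
    β≡ = trans (cong (suc n ∸_) (sym α≡2b)) (trans (cong (λ z → suc z ∸ α) (sym α+β))
           (trans (+-∸-assoc 1 (m≤m+n α β)) (cong suc (m+n∸m≡n α β))))

module _ (m e : ℕ) (e<m : e < m) where

  private
    tailInsertions : List ℕ → List (List ℕ)
    tailInsertions []      = []
    tailInsertions (y ∷ u) = map (y ∷_) (insertions m u)

    insertions≡front∷tail : ∀ u → insertions m u ≡ (m ∷ u) ∷ tailInsertions u
    insertions≡front∷tail []      = refl
    insertions≡front∷tail (y ∷ u) = refl

    -- insertions of m after the first letter of u, with u preceded by p and followed by e
    tailCount : ℕ → List ℕ → ℕ → ℕ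
    tailCount p []      t = 0
    tailCount p (x ∷ u) t = sumMap (λ w → δ (peaksFrom p (x ∷ (w ++ [ e ]))) t) (insertions m u)

    peaks-front : ∀ p u → p < m → All (_< m) u →
                  peaksFrom p (m ∷ (u ++ [ e ])) + 𝟙 (headIsPeakAfter p (u ++ [ e ])) ≡ suc (peaksFrom p (u ++ [ e ]))
    peaks-front p []          p<m _         rewrite <⇒<ᵇ≡true p<m | <⇒<ᵇ≡true e<m = refl
    peaks-front p (x ∷ u)     p<m (x<m ∷ _) = front p x (u ++ [ e ]) p<m x<m
      where
      front : ∀ p x s → p < m → x < m → peaksFrom p (m ∷ x ∷ s) + 𝟙 (isPeakAfter p x s) ≡ suc (peaksFrom p (x ∷ s))
      front p x []      p<m x<m rewrite <⇒<ᵇ≡true p<m | <⇒<ᵇ≡true x<m = refl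
      front p x (y ∷ r) p<m x<m rewrite <⇒<ᵇ≡true p<m | <⇒<ᵇ≡true x<m | ≤⇒<ᵇ≡false (<⇒≤ x<m) =
        cong suc (+-comm (peaksFrom x (y ∷ r)) _)

    peaks-after-max : ∀ p x s → x < m → peaksFrom p (x ∷ m ∷ s) ≡ peaksFrom x (m ∷ s)
    peaks-after-max p x s x<m rewrite ≤⇒<ᵇ≡false (<⇒≤ x<m) | ∧-zeroʳ (p <ᵇ x) = refl

    sumMap-tailInsertions : ∀ p x u t → sumMap (λ w → δ (peaksFrom p (x ∷ (w ++ [ e ]))) t) (tailInsertions u) ≡
                                        shiftBy (isPeakAfter p x (u ++ [ e ])) (tailCount x u) t
    sumMap-tailInsertions p x []      t with isPeakAfter p x ([] ++ [ e ])
    ... | false = refl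
    sumMap-tailInsertions p x [] zero    | true = refl
    sumMap-tailInsertions p x [] (suc t) | true = refl
    sumMap-tailInsertions p x (y ∷ u) t = trans (sumMap-map _ (y ∷_) (insertions m u)) (shift ((p <ᵇ x) ∧ (y <ᵇ x)) t)
      where
      shift : ∀ b t → sumMap (λ w → δ (𝟙 b + peaksFrom x (y ∷ (w ++ [ e ]))) t) (insertions m u) ≡
                      shiftBy b (tailCount x (y ∷ u)) t
      shift false t       = refl
      shift true  zero    = sumMap-zero (insertions m u)
        where
        sumMap-zero : {A : Set} (xs : List A) → sumMap (λ _ → 0) xs ≡ 0
        sumMap-zero []       = refl
        sumMap-zero (_ ∷ xs) = sumMap-zero xs
      shift true  (suc t) = refl

    tailCount-counts : ∀ p u → p < m → All (_< m) u → Σ ℕ λ α → Σ ℕ λ β →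
      α + 𝟙 (headIsPeakAfter p (u ++ [ e ])) ≡ 2 * peaksFrom p (u ++ [ e ]) × α + β ≡ length u ×
      Counts (tailCount p u) (peaksFrom p (u ++ [ e ])) α β
    tailCount-counts p []      _   _           = 0 , 0 , refl , refl , λ t → sym (cong₂ _+_ (*-zeroʳ (δ 0 t)) (*-zeroʳ (δ 1 t)))
    tailCount-counts p (x ∷ u) p<m (x<m ∷ u<m) with tailCount-counts x u x<m u<m
    ... | α₁ , β₁ , α₁≡ , α₁+β₁ , counts₁
      with tail-step (isPeakAfter p x (u ++ [ e ])) (headIsPeakAfter x (u ++ [ e ])) (peaksFrom x (u ++ [ e ]))
                     (peaksFrom p (x ∷ m ∷ (u ++ [ e ]))) α₁ β₁ (length u) (tailCount x u)
                     (isPeakAfter⇒¬headIsPeakAfter p x (u ++ [ e ])) v≡ α₁≡ α₁+β₁ counts₁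
      where
      v≡ : peaksFrom p (x ∷ m ∷ (u ++ [ e ])) + 𝟙 (headIsPeakAfter x (u ++ [ e ])) ≡ suc (peaksFrom x (u ++ [ e ]))
      v≡ = trans (cong (_+ _) (peaks-after-max p x (u ++ [ e ]) x<m)) (peaks-front x u x<m u<m)
    ... | α , β , α≡ , α+β , counts = α , β , trans α≡ (cong (2 *_) (sym (peaksFrom-∷ p x (u ++ [ e ])))) , α+β , counts′
      where
      counts′ : Counts (tailCount p (x ∷ u)) (peaksFrom p (x ∷ (u ++ [ e ]))) α β
      counts′ t = begin
        tailCount p (x ∷ u) t
          ≡⟨ cong (sumMap (λ w → δ (peaksFrom p (x ∷ (w ++ [ e ]))) t)) (insertions≡front∷tail u) ⟩
        δ (peaksFrom p (x ∷ m ∷ (u ++ [ e ]))) t + sumMap (λ w → δ (peaksFrom p (x ∷ (w ++ [ e ]))) t) (tailInsertions u)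
          ≡⟨ cong (δ (peaksFrom p (x ∷ m ∷ (u ++ [ e ]))) t +_) (sumMap-tailInsertions p x u t) ⟩
        δ (peaksFrom p (x ∷ m ∷ (u ++ [ e ]))) t + shiftBy (isPeakAfter p x (u ++ [ e ])) (tailCount x u) t
          ≡⟨ counts t ⟩
        δ b t * α + δ (suc b) t * β
          ≡⟨ cong (λ z → δ z t * α + δ (suc z) t * β) (sym (peaksFrom-∷ p x (u ++ [ e ]))) ⟩
        δ (peaksFrom p (x ∷ (u ++ [ e ]))) t * α + δ (suc (peaksFrom p (x ∷ (u ++ [ e ])))) t * β ∎
        where b = 𝟙 (isPeakAfter p x (u ++ [ e ])) + peaksFrom x (u ++ [ e ])

  -- Inserting the maximum m next to one of the b peaks keeps b peaks; each other slot creates a new peak.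
  insertions-peakCount : ∀ p u → p < m → All (_< m) u →
    Counts (λ t → sumMap (λ w → δ (peaksFrom p (w ++ [ e ])) t) (insertions m u))
           (peaksFrom p (u ++ [ e ])) (2 * peaksFrom p (u ++ [ e ])) (suc (length u) ∸ 2 * peaksFrom p (u ++ [ e ]))
  insertions-peakCount p u p<m u<m t with tailCount-counts p u p<m u<m
  ... | α , β , α≡ , α+β , counts = begin
    sumMap (λ w → δ (peaksFrom p (w ++ [ e ])) t) (insertions m u)
      ≡⟨ front∷tail u ⟩
    δ (peaksFrom p (m ∷ (u ++ [ e ]))) t + tailCount p u t
      ≡⟨ cong (δ (peaksFrom p (m ∷ (u ++ [ e ]))) t +_) (counts t) ⟩
    δ (peaksFrom p (m ∷ (u ++ [ e ]))) t + (δ b t * α + δ (suc b) t * β)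
      ≡⟨ front+tail (headIsPeakAfter p (u ++ [ e ])) b _ α β (length u) (peaks-front p u p<m u<m) α≡ α+β t ⟩
    δ b t * (2 * b) + δ (suc b) t * (suc (length u) ∸ 2 * b) ∎
    where
    b = peaksFrom p (u ++ [ e ])
    front∷tail : ∀ u → sumMap (λ w → δ (peaksFrom p (w ++ [ e ])) t) (insertions m u) ≡
                        δ (peaksFrom p (m ∷ (u ++ [ e ]))) t + tailCount p u t
    front∷tail []      = refl
    front∷tail (x ∷ u) = cong (δ (peaksFrom p (m ∷ x ∷ (u ++ [ e ]))) t +_) (sumMap-map _ (x ∷_) (insertions m u))

peaksFrom-++-max : ∀ M p v → All (_< M) v → peaksFrom p (v ++ [ M ]) ≡ peaksFrom p v
peaksFrom-++-max M p []          _            = refl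
peaksFrom-++-max M p (x ∷ [])    (x<M ∷ _)    rewrite ≤⇒<ᵇ≡false (<⇒≤ x<M) | ∧-zeroʳ (p <ᵇ x) = refl
peaksFrom-++-max M p (x ∷ y ∷ v) (_ ∷ v<M)    = cong (𝟙 ((p <ᵇ x) ∧ (y <ᵇ x)) +_) (peaksFrom-++-max M x (y ∷ v) v<M)

-- The last entry is never a left peak, so it acts as the sentinel; inserting m at the very end changes nothing.
leftPeaks-insertions-counts : ∀ m → 0 < m → ∀ u → All (_< m) u →
  Counts (λ t → sumMap (λ w → δ (leftPeaks w) t) (insertions m u)) (leftPeaks u) (suc (2 * leftPeaks u)) (length u ∸ 2 * leftPeaks u)
leftPeaks-insertions-counts m 0<m u u<m t = go u (initLast u) u<m
  where
  go : ∀ u → InitLast u → All (_< m) u →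
    sumMap (λ w → δ (leftPeaks w) t) (insertions m u) ≡
    δ (leftPeaks u) t * suc (2 * leftPeaks u) + δ (suc (leftPeaks u)) t * (length u ∸ 2 * leftPeaks u)
  go .[]            InitLast.[] _   = sym (cong₂ _+_ (*-identityʳ (δ 0 t)) (*-zeroʳ (δ 1 t)))
  go .(v ++ [ z ]) (v ∷ʳ′ z)   v∷z<m = begin
    sumMap f (insertions m (v ++ z ∷ []))
      ≡⟨ cong (sumMap f) (insertions-++ m v z []) ⟩
    sumMap f (map (_++ [ z ]) (insertions m v) ++ map ((v ++ [ z ]) ++_) [ [ m ] ])
      ≡⟨ sumMap-++ f (map (_++ [ z ]) (insertions m v)) _ ⟩
    sumMap f (map (_++ [ z ]) (insertions m v)) + (f ((v ++ [ z ]) ++ [ m ]) + 0)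
      ≡⟨ cong₂ _+_ (trans (sumMap-map f _ (insertions m v)) (insertions-peakCount m z z<m 0 v 0<m v<m t))
                   (trans (+-identityʳ _) (cong (λ q → δ q t) (peaksFrom-++-max m 0 (v ++ [ z ]) v∷z<m))) ⟩
    δ b t * (2 * b) + δ (suc b) t * (suc (length v) ∸ 2 * b) + δ b t
      ≡⟨ trans (+-comm _ (δ b t)) (sym (+-assoc (δ b t) _ _)) ⟩
    δ b t + δ b t * (2 * b) + δ (suc b) t * (suc (length v) ∸ 2 * b)
      ≡⟨ cong₂ (λ x y → x + δ (suc b) t * (y ∸ 2 * b)) (sym (*-suc (δ b t) (2 * b))) (sym length-v∷z) ⟩
    δ b t * suc (2 * b) + δ (suc b) t * (length (v ++ [ z ]) ∸ 2 * b) ∎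
    where
    f : List ℕ → ℕ
    f w = δ (leftPeaks w) t
    b = leftPeaks (v ++ [ z ])
    v<m : All (_< m) v
    v<m = ++⁻ˡ v v∷z<m
    z<m : z < m
    z<m with ++⁻ʳ v {[ z ]} v∷z<m
    ... | z<m ∷ _ = z<m
    length-v∷z : length (v ++ [ z ]) ≡ suc (length v)
    length-v∷z = trans (length-++ v) (+-comm (length v) 1)

exteriorPeaks-insertions-counts : ∀ m → 0 < m → ∀ u → All (_< m) u →
  Counts (λ t → sumMap (λ w → δ (exteriorPeaks w) t) (insertions m u))
         (exteriorPeaks u) (2 * exteriorPeaks u) (suc (length u) ∸ 2 * exteriorPeaks u)
exteriorPeaks-insertions-counts m 0<m u = insertions-peakCount m 0 0<m 0 u 0<m

-- byX t g is the coefficient of xᵗ in x · Σₛ g s xˢ.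
byX : ℕ → (ℕ → ℕ) → ℕ
byX zero    g = 0
byX (suc t) g = g t

byX-cong : ∀ t {f g : ℕ → ℕ} → (∀ s → f s ≡ g s) → byX t f ≡ byX t g
byX-cong zero    f≗g = refl
byX-cong (suc t) f≗g = f≗g t

*-distribˡ-byX : ∀ t c (g : ℕ → ℕ) → c * byX t g ≡ byX t (λ s → c * g s)
*-distribˡ-byX zero    c g = *-zeroʳ c
*-distribˡ-byX (suc t) c g = refl

sumMap-byX : {A : Set} (xs : List A) (t : ℕ) (g : A → ℕ → ℕ) →
             sumMap (λ x → byX t (g x)) xs ≡ byX t (λ s → sumMap (λ x → g x s) xs)
sumMap-byX []       zero    g = refl
sumMap-byX []       (suc t) g = refl
sumMap-byX (x ∷ xs) zero    g = sumMap-byX xs zero g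
sumMap-byX (x ∷ xs) (suc t) g = cong (g x t +_) (sumMap-byX xs (suc t) g)

δ-suc≡byX : ∀ p i (Z : ℕ → ℕ) → δ (suc p) i * Z p ≡ byX i (λ s → δ p s * Z s)
δ-suc≡byX p zero    Z = refl
δ-suc≡byX p (suc i) Z = δ-subst p i Z

-- Inserting a new maximum into objects whose peak statistic is distributed as g: a t of those with t peaks
-- keep t peaks, and c s of those with s peaks get one more.
insertionStep : (a c g : ℕ → ℕ) → ℕ → ℕ
insertionStep a c g t = a t * g t + byX t (λ s → c s * g s)

insertionStep-cong : ∀ a c {g h : ℕ → ℕ} t → (∀ s → g s ≡ h s) → insertionStep a c g t ≡ insertionStep a c h t
insertionStep-cong a c t g≗h = cong₂ _+_ (cong (a t *_) (g≗h t)) (byX-cong t (λ s → cong (c s *_) (g≗h s)))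

*-distribˡ-insertionStep : ∀ a c g t k → k * insertionStep a c g t ≡ insertionStep a c (λ s → k * g s) t
*-distribˡ-insertionStep a c g t k = begin
  k * (a t * g t + byX t (λ s → c s * g s))          ≡⟨ *-distribˡ-+ k (a t * g t) _ ⟩
  k * (a t * g t) + k * byX t (λ s → c s * g s)      ≡⟨ cong₂ _+_ (x∙yz≈y∙xz k (a t) (g t)) (*-distribˡ-byX t k _) ⟩
  a t * (k * g t) + byX t (λ s → k * (c s * g s))    ≡⟨ cong (a t * (k * g t) +_) (byX-cong t (λ s → x∙yz≈y∙xz k (c s) (g s))) ⟩
  a t * (k * g t) + byX t (λ s → c s * (k * g s))    ∎

sumMap-insertionStep : {A : Set} (xs : List A) (a c : ℕ → ℕ) (g : A → ℕ → ℕ) (t : ℕ) →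
  sumMap (λ x → insertionStep a c (g x) t) xs ≡ insertionStep a c (λ s → sumMap (λ x → g x s) xs) t
sumMap-insertionStep xs a c g t = trans (sumMap-+ _ _ xs) (cong₂ _+_ (sumMap-*ˡ (a t) (λ x → g x t) xs)
  (trans (sumMap-byX xs t (λ x s → c s * g x s)) (byX-cong t (λ s → sumMap-*ˡ (c s) (λ x → g x s) xs))))

Counts⇒insertionStep : ∀ {g b t} (a c : ℕ → ℕ) → Counts g b (a b) (c b) → g t ≡ insertionStep a c (δ b) t
Counts⇒insertionStep {g} {b} {zero}  a c counts = trans (counts 0)
  (trans (+-identityʳ _) (trans (δ-subst b 0 a) (trans (*-comm (δ b 0) _) (sym (+-identityʳ _)))))
Counts⇒insertionStep {g} {b} {suc t} a c counts = trans (counts (suc t))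
  (cong₂ _+_ (trans (δ-subst b (suc t) a) (*-comm (δ b (suc t)) _)) (trans (δ-subst b t c) (*-comm (δ b t) _)))

exteriorStep : ℕ → (ℕ → ℕ) → ℕ → ℕ
exteriorStep n = insertionStep (2 *_) (λ s → suc n ∸ 2 * s)

leftStep : ℕ → (ℕ → ℕ) → ℕ → ℕ
leftStep n = insertionStep (λ b → suc (2 * b)) (λ s → n ∸ 2 * s)

countPerms : (List ℕ → ℕ) → ℕ → ℕ → ℕ
countPerms stat n k = sumMap (λ w → δ (stat w) k) (perms n)

exteriorPeaks-insertions : ∀ m → 0 < m → ∀ u → All (_< m) u → ∀ t →
  sumMap (λ w → δ (exteriorPeaks w) t) (insertions m u) ≡
  exteriorStep (length u) (δ (exteriorPeaks u)) t
exteriorPeaks-insertions m 0<m u u<m t =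
  Counts⇒insertionStep (2 *_) (λ b → suc (length u) ∸ 2 * b) (exteriorPeaks-insertions-counts m 0<m u u<m)

leftPeaks-insertions : ∀ m → 0 < m → ∀ u → All (_< m) u → ∀ t →
  sumMap (λ w → δ (leftPeaks w) t) (insertions m u) ≡
  leftStep (length u) (δ (leftPeaks u)) t
leftPeaks-insertions m 0<m u u<m t =
  Counts⇒insertionStep (λ b → suc (2 * b)) (λ b → length u ∸ 2 * b) (leftPeaks-insertions-counts m 0<m u u<m)

private
  perm<suc : ∀ n τ → τ ∈ perms n → All (_< suc n) τ
  perm<suc n τ τ∈ = All.map (λ (_ , x≤n) → s≤s x≤n) (proj₁ (proj₂ (∈-perms⁻ n τ τ∈)))

  length-perm : ∀ n τ → τ ∈ perms n → length τ ≡ n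
  length-perm n τ τ∈ = proj₁ (∈-perms⁻ n τ τ∈)

exteriorPeaks-recurrence : ∀ i j →
  countPerms exteriorPeaks (suc i) j ≡ exteriorStep i (countPerms exteriorPeaks i) j
exteriorPeaks-recurrence i j = begin
  countPerms exteriorPeaks (suc i) j
    ≡⟨ sumMap-perms-suc i _ ⟩
  sumMap (λ τ → sumMap (λ w → δ (exteriorPeaks w) j) (insertions (suc i) τ)) (perms i)
    ≡⟨ sumMap-cong (perms i) (λ τ τ∈ → trans (exteriorPeaks-insertions (suc i) (s≤s z≤n) τ (perm<suc i τ τ∈) j)
         (cong (λ n → exteriorStep n (δ (exteriorPeaks τ)) j) (length-perm i τ τ∈))) ⟩
  sumMap (λ τ → exteriorStep i (δ (exteriorPeaks τ)) j) (perms i)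
    ≡⟨ sumMap-insertionStep (perms i) (2 *_) (λ s → suc i ∸ 2 * s) _ j ⟩
  exteriorStep i (countPerms exteriorPeaks i) j ∎

leftPeaks-recurrence : ∀ i l →
  countPerms leftPeaks (suc i) l ≡ leftStep i (countPerms leftPeaks i) l
leftPeaks-recurrence i l = begin
  countPerms leftPeaks (suc i) l
    ≡⟨ sumMap-perms-suc i _ ⟩
  sumMap (λ τ → sumMap (λ w → δ (leftPeaks w) l) (insertions (suc i) τ)) (perms i)
    ≡⟨ sumMap-cong (perms i) (λ τ τ∈ → trans (leftPeaks-insertions (suc i) (s≤s z≤n) τ (perm<suc i τ τ∈) l)
         (cong (λ n → leftStep n (δ (leftPeaks τ)) l) (length-perm i τ τ∈))) ⟩
  sumMap (λ τ → leftStep i (δ (leftPeaks τ)) l) (perms i)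
    ≡⟨ sumMap-insertionStep (perms i) (λ b → suc (2 * b)) (λ s → i ∸ 2 * s) _ l ⟩
  leftStep i (countPerms leftPeaks i) l ∎

-- Splitting a permutation at its entry 1

private
  peaksFrom-1≡peaksFrom-0 : ∀ B → All (1 <_) B → peaksFrom 1 B ≡ peaksFrom 0 B
  peaksFrom-1≡peaksFrom-0 []          _         = refl
  peaksFrom-1≡peaksFrom-0 (b ∷ [])    _         = refl
  peaksFrom-1≡peaksFrom-0 (b ∷ c ∷ B) (1<b ∷ _) rewrite <⇒<ᵇ≡true 1<b | <⇒<ᵇ≡true (<-trans (s≤s z≤n) 1<b) = refl

  peaksFrom-1∷ : ∀ p B → All (1 <_) B → peaksFrom p (1 ∷ B) ≡ peaksFrom 0 B
  peaksFrom-1∷ p []      _          = refl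
  peaksFrom-1∷ p (b ∷ B) (1<b ∷ 1<B) rewrite ≤⇒<ᵇ≡false (<⇒≤ 1<b) | ∧-zeroʳ (p <ᵇ 1) = peaksFrom-1≡peaksFrom-0 (b ∷ B) (1<b ∷ 1<B)

-- An entry 1 is a valley: it cuts a word into two independent blocks, the first one ending before a 0.
peaksFrom-++-1∷ : ∀ p A B → All (1 <_) A → All (1 <_) B → peaksFrom p (A ++ 1 ∷ B) ≡ peaksFrom p (A ++ [ 0 ]) + peaksFrom 0 B
peaksFrom-++-1∷ p []           B _          1<B = peaksFrom-1∷ p B 1<B
peaksFrom-++-1∷ p (a ∷ [])     B (1<a ∷ _)  1<B rewrite <⇒<ᵇ≡true 1<a | <⇒<ᵇ≡true (<-trans (s≤s z≤n) 1<a) =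
  trans (cong (𝟙 ((p <ᵇ a) ∧ true) +_) (peaksFrom-1∷ a B 1<B)) (cong (_+ peaksFrom 0 B) (sym (+-identityʳ _)))
peaksFrom-++-1∷ p (a ∷ a′ ∷ A) B (_ ∷ 1<A)  1<B =
  trans (cong (𝟙 ((p <ᵇ a) ∧ (a′ <ᵇ a)) +_) (peaksFrom-++-1∷ a (a′ ∷ A) B 1<A 1<B)) (sym (+-assoc (𝟙 ((p <ᵇ a) ∧ (a′ <ᵇ a))) _ _))

leftPeaks-++-1∷ : ∀ A B → All (1 <_) A → All (1 <_) B → leftPeaks (A ++ 1 ∷ B) ≡ exteriorPeaks A + leftPeaks B
leftPeaks-++-1∷ = peaksFrom-++-1∷ 0

beforeOne : List ℕ → List ℕ
beforeOne []       = []
beforeOne (x ∷ xs) = if x ≡ᵇ 1 then [] else x ∷ beforeOne xs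

afterOne : List ℕ → List ℕ
afterOne []       = []
afterOne (x ∷ xs) = if x ≡ᵇ 1 then xs else afterOne xs

private
  1<⇒≡ᵇ1≡false : ∀ {x} → 1 < x → (x ≡ᵇ 1) ≡ false
  1<⇒≡ᵇ1≡false 1<x = ≢⇒≡ᵇ≡false (>⇒≢ 1<x)

beforeOne-++-1∷ : ∀ A B → All (1 <_) A → beforeOne (A ++ 1 ∷ B) ≡ A
beforeOne-++-1∷ []      B _           = refl
beforeOne-++-1∷ (a ∷ A) B (1<a ∷ 1<A) rewrite 1<⇒≡ᵇ1≡false 1<a = cong (a ∷_) (beforeOne-++-1∷ A B 1<A)

afterOne-++-1∷ : ∀ A B → All (1 <_) A → afterOne (A ++ 1 ∷ B) ≡ B
afterOne-++-1∷ []      B _           = refl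
afterOne-++-1∷ (a ∷ A) B (1<a ∷ 1<A) rewrite 1<⇒≡ᵇ1≡false 1<a = afterOne-++-1∷ A B 1<A

1∈perm : ∀ n σ → σ ∈ perms (suc n) → 1 ∈ σ
1∈perm n σ σ∈ with perm-suc-split n σ σ∈
... | A , B , refl , A++B∈ = 1∈ n A B A++B∈
  where
  1∈ : ∀ n A B → A ++ B ∈ perms n → 1 ∈ A ++ suc n ∷ B
  1∈ zero    [] [] _ = here refl
  1∈ zero    (_ ∷ _) _ A++B∈ with () ← proj₁ (∈-perms⁻ 0 _ A++B∈)
  1∈ zero    [] (_ ∷ _) A++B∈ with () ← proj₁ (∈-perms⁻ 0 _ A++B∈)
  1∈ (suc n) A B A++B∈ with ∈-++⁻ A (1∈perm n (A ++ B) A++B∈)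
  ... | inj₁ 1∈A = ∈-++⁺ˡ 1∈A
  ... | inj₂ 1∈B = ∈-++⁺ʳ A (there 1∈B)

record SplitAtOne (n : ℕ) (σ : List ℕ) : Set where
  field
    A B         : List ℕ
    σ≡A++1∷B    : σ ≡ A ++ 1 ∷ B
    1<A         : All (1 <_) A
    1<B         : All (1 <_) B
    A<2+n       : All (_< suc (suc n)) A
    B<2+n       : All (_< suc (suc n)) B
    |A|+|B|≡n   : length A + length B ≡ n

splitAtOne : ∀ n σ → σ ∈ perms (suc n) → SplitAtOne n σ
splitAtOne n σ σ∈ with ∈-∃++ (1∈perm n σ σ∈) | ∈-perms⁻ (suc n) σ σ∈
... | A , B , refl | len , inRange , u = record
  { A = A ; B = B ; σ≡A++1∷B = refl
  ; 1<A = ++⁻ˡ A 1<A++B ; 1<B = ++⁻ʳ A 1<A++B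
  ; A<2+n = ++⁻ˡ A <2+n ; B<2+n = ++⁻ʳ A <2+n
  ; |A|+|B|≡n = suc-injective (trans (cong suc (sym (length-++ A))) (trans (sym (length-middle A)) len))
  }
  where
  inRange′ = proj₂ (All-middle⁻ A inRange)
  1<A++B : All (1 <_) (A ++ B)
  1<A++B = All.zipWith (λ ((0<x , _) , 1≢x) → ≤∧≢⇒< 0<x 1≢x) (inRange′ , proj₁ (Unique-middle⁻ A u))
  <2+n : All (_< suc (suc n)) (A ++ B)
  <2+n = All.map (λ (_ , x≤1+n) → s≤s x≤1+n) inRange′

-- From the distribution G of (|A|, ext A, left B) over the permutations A 1 B of [n + 1] to that over [n + 2]:
-- the new maximum n + 2 is inserted either into A or into B.
insertMax : ℕ → (ℕ → ℕ → ℕ → ℕ) → ℕ → ℕ → ℕ → ℕ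
insertMax n G i j l = byX i (λ i′ → exteriorStep i′ (λ j → G i′ j l) j) + leftStep (n ∸ i) (G i j) l

insertMax-cong : ∀ n {G H : ℕ → ℕ → ℕ → ℕ} → (∀ a b c → G a b c ≡ H a b c) → ∀ i j l → insertMax n G i j l ≡ insertMax n H i j l
insertMax-cong n G≗H i j l = cong₂ _+_
  (byX-cong i (λ i′ → insertionStep-cong (2 *_) (λ s → suc i′ ∸ 2 * s) j (λ s → G≗H i′ s l)))
  (insertionStep-cong (λ b → suc (2 * b)) (λ s → n ∸ i ∸ 2 * s) l (G≗H i j))

sumMap-insertMax : {X : Set} (xs : List X) (n : ℕ) (G : X → ℕ → ℕ → ℕ → ℕ) (i j l : ℕ) →
  sumMap (λ x → insertMax n (G x) i j l) xs ≡ insertMax n (λ a b c → sumMap (λ x → G x a b c) xs) i j l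
sumMap-insertMax xs n G i j l = trans (sumMap-+ _ _ xs) (cong₂ _+_
  (trans (sumMap-byX xs i _) (byX-cong i (λ i′ → sumMap-insertionStep xs (2 *_) (λ s → suc i′ ∸ 2 * s) (λ x j → G x i′ j l) j)))
  (sumMap-insertionStep xs (λ b → suc (2 * b)) (λ s → n ∸ i ∸ 2 * s) (λ x → G x i j) l))

splitStats : List ℕ → List ℕ → ℕ → ℕ → ℕ → ℕ
splitStats A B i j l = δ (length A) i * (δ (exteriorPeaks A) j * δ (leftPeaks B) l)

splitCount : ℕ → ℕ → ℕ → ℕ → ℕ
splitCount n i j l = sumMap (λ σ → splitStats (beforeOne σ) (afterOne σ) i j l) (perms (suc n))

module _ (n m : ℕ) (1<m : 1 < m) (A B : List ℕ) (1<A : All (1 <_) A) (1<B : All (1 <_) B)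
         (A<m : All (_< m) A) (B<m : All (_< m) B) (|A|+|B|≡n : length A + length B ≡ n) where

  private
    0<m : 0 < m
    0<m = <-trans (s≤s z≤n) 1<m

    splitStats-into-A : ∀ i j l w → w ∈ insertions m A →
      splitStats (beforeOne (w ++ 1 ∷ B)) (afterOne (w ++ 1 ∷ B)) i j l ≡
      (δ (suc (length A)) i * δ (leftPeaks B) l) * δ (exteriorPeaks w) j
    splitStats-into-A i j l w w∈ with ∈-insertions⁻ m A w w∈
    ... | X , Y , refl , refl = begin
      splitStats (beforeOne ((X ++ m ∷ Y) ++ 1 ∷ B)) (afterOne ((X ++ m ∷ Y) ++ 1 ∷ B)) i j l
        ≡⟨ cong₂ (λ A′ B′ → splitStats A′ B′ i j l) (beforeOne-++-1∷ (X ++ m ∷ Y) B 1<w) (afterOne-++-1∷ (X ++ m ∷ Y) B 1<w) ⟩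
      δ (length (X ++ m ∷ Y)) i * (δ (exteriorPeaks (X ++ m ∷ Y)) j * δ (leftPeaks B) l)
        ≡⟨ cong (λ a → δ a i * (δ (exteriorPeaks (X ++ m ∷ Y)) j * δ (leftPeaks B) l)) (length-middle X) ⟩
      δ (suc (length (X ++ Y))) i * (δ (exteriorPeaks (X ++ m ∷ Y)) j * δ (leftPeaks B) l)
        ≡⟨ solve 3 (λ a b c → a :* (b :* c) := (a :* c) :* b) refl (δ (suc (length (X ++ Y))) i) _ (δ (leftPeaks B) l) ⟩
      (δ (suc (length (X ++ Y))) i * δ (leftPeaks B) l) * δ (exteriorPeaks (X ++ m ∷ Y)) j ∎
      where
      1<w : All (1 <_) (X ++ m ∷ Y)
      1<w = All-middle⁺ X 1<m 1<A

    splitStats-into-B : ∀ i j l v →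
      splitStats (beforeOne ((A ++ [ 1 ]) ++ v)) (afterOne ((A ++ [ 1 ]) ++ v)) i j l ≡
      (δ (length A) i * δ (exteriorPeaks A) j) * δ (leftPeaks v) l
    splitStats-into-B i j l v rewrite ++-assoc A [ 1 ] v | beforeOne-++-1∷ A v 1<A | afterOne-++-1∷ A v 1<A =
      sym (*-assoc (δ (length A) i) _ _)

    total-into-A : ∀ i j l → (δ (suc (length A)) i * δ (leftPeaks B) l) * exteriorStep (length A) (δ (exteriorPeaks A)) j ≡
                       byX i (λ i′ → exteriorStep i′ (λ j → splitStats A B i′ j l) j)
    total-into-A i j l = begin
      (δ (suc a) i * δ b l) * exteriorStep a (δ e) j
        ≡⟨ *-assoc (δ (suc a) i) _ _ ⟩
      δ (suc a) i * (δ b l * exteriorStep a (δ e) j)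
        ≡⟨ δ-suc≡byX a i (λ a′ → δ b l * exteriorStep a′ (δ e) j) ⟩
      byX i (λ i′ → δ a i′ * (δ b l * exteriorStep i′ (δ e) j))
        ≡⟨ byX-cong i (λ i′ → begin
             δ a i′ * (δ b l * exteriorStep i′ (δ e) j)
               ≡⟨ cong (δ a i′ *_) (*-distribˡ-insertionStep (2 *_) (λ s → suc i′ ∸ 2 * s) (δ e) j (δ b l)) ⟩
             δ a i′ * exteriorStep i′ (λ s → δ b l * δ e s) j
               ≡⟨ *-distribˡ-insertionStep (2 *_) (λ s → suc i′ ∸ 2 * s) _ j (δ a i′) ⟩
             exteriorStep i′ (λ s → δ a i′ * (δ b l * δ e s)) j
               ≡⟨ insertionStep-cong (2 *_) (λ s → suc i′ ∸ 2 * s) j (λ s → cong (δ a i′ *_) (*-comm (δ b l) (δ e s))) ⟩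
             exteriorStep i′ (λ s → splitStats A B i′ s l) j ∎) ⟩
      byX i (λ i′ → exteriorStep i′ (λ j → splitStats A B i′ j l) j) ∎
      where
      a = length A
      b = leftPeaks B
      e = exteriorPeaks A

    total-into-B : ∀ i j l → (δ (length A) i * δ (exteriorPeaks A) j) * leftStep (length B) (δ (leftPeaks B)) l ≡
                       leftStep (n ∸ i) (splitStats A B i j) l
    total-into-B i j l = begin
      (δ a i * δ e j) * leftStep (length B) (δ b) l
        ≡⟨ cong (λ k → (δ a i * δ e j) * leftStep k (δ b) l) |B|≡n∸|A| ⟩
      (δ a i * δ e j) * leftStep (n ∸ a) (δ b) l
        ≡⟨ *-assoc (δ a i) _ _ ⟩
      δ a i * (δ e j * leftStep (n ∸ a) (δ b) l)
        ≡⟨ δ-subst a i (λ a′ → δ e j * leftStep (n ∸ a′) (δ b) l) ⟩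
      δ a i * (δ e j * leftStep (n ∸ i) (δ b) l)
        ≡⟨ cong (δ a i *_) (*-distribˡ-insertionStep (λ t → suc (2 * t)) (λ s → n ∸ i ∸ 2 * s) (δ b) l (δ e j)) ⟩
      δ a i * leftStep (n ∸ i) (λ s → δ e j * δ b s) l
        ≡⟨ *-distribˡ-insertionStep (λ t → suc (2 * t)) (λ s → n ∸ i ∸ 2 * s) _ l (δ a i) ⟩
      leftStep (n ∸ i) (splitStats A B i j) l ∎
      where
      a = length A
      b = leftPeaks B
      e = exteriorPeaks A
      |B|≡n∸|A| : length B ≡ n ∸ length A
      |B|≡n∸|A| = trans (sym (m+n∸m≡n (length A) (length B))) (cong (_∸ length A) |A|+|B|≡n)

  insertions-splitStats : ∀ i j l →
    sumMap (λ w → splitStats (beforeOne w) (afterOne w) i j l) (insertions m (A ++ 1 ∷ B)) ≡ insertMax n (splitStats A B) i j l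
  insertions-splitStats i j l = begin
    sumMap f (insertions m (A ++ 1 ∷ B))
      ≡⟨ cong (sumMap f) (insertions-++ m A 1 B) ⟩
    sumMap f (map (_++ 1 ∷ B) (insertions m A) ++ map ((A ++ [ 1 ]) ++_) (insertions m B))
      ≡⟨ sumMap-++ f (map (_++ 1 ∷ B) (insertions m A)) _ ⟩
    sumMap f (map (_++ 1 ∷ B) (insertions m A)) + sumMap f (map ((A ++ [ 1 ]) ++_) (insertions m B))
      ≡⟨ cong₂ _+_
           (trans (sumMap-map f _ (insertions m A)) (trans (sumMap-cong (insertions m A) (splitStats-into-A i j l))
             (sumMap-*ˡ (δ (suc (length A)) i * δ (leftPeaks B) l) (λ w → δ (exteriorPeaks w) j) (insertions m A))))
           (trans (sumMap-map f _ (insertions m B)) (trans (sumMap-cong (insertions m B) (λ v _ → splitStats-into-B i j l v))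
             (sumMap-*ˡ (δ (length A) i * δ (exteriorPeaks A) j) (λ v → δ (leftPeaks v) l) (insertions m B)))) ⟩
    (δ (suc (length A)) i * δ (leftPeaks B) l) * sumMap (λ w → δ (exteriorPeaks w) j) (insertions m A) +
    (δ (length A) i * δ (exteriorPeaks A) j) * sumMap (λ v → δ (leftPeaks v) l) (insertions m B)
      ≡⟨ cong₂ _+_ (cong ((δ (suc (length A)) i * δ (leftPeaks B) l) *_) (exteriorPeaks-insertions m 0<m A A<m j))
                   (cong ((δ (length A) i * δ (exteriorPeaks A) j) *_) (leftPeaks-insertions m 0<m B B<m l)) ⟩
    (δ (suc (length A)) i * δ (leftPeaks B) l) * exteriorStep (length A) (δ (exteriorPeaks A)) j +
    (δ (length A) i * δ (exteriorPeaks A) j) * leftStep (length B) (δ (leftPeaks B)) l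
      ≡⟨ cong₂ _+_ (total-into-A i j l) (total-into-B i j l) ⟩
    insertMax n (splitStats A B) i j l ∎
    where
    f : List ℕ → ℕ
    f w = splitStats (beforeOne w) (afterOne w) i j l

private
  splitStats-of-split : ∀ n σ (s : SplitAtOne n σ) i j l →
    splitStats (beforeOne σ) (afterOne σ) i j l ≡ splitStats (SplitAtOne.A s) (SplitAtOne.B s) i j l
  splitStats-of-split n σ s i j l = begin
    splitStats (beforeOne σ) (afterOne σ) i j l
      ≡⟨ cong (λ τ → splitStats (beforeOne τ) (afterOne τ) i j l) σ≡A++1∷B ⟩
    splitStats (beforeOne (A ++ 1 ∷ B)) (afterOne (A ++ 1 ∷ B)) i j l
      ≡⟨ cong₂ (λ A′ B′ → splitStats A′ B′ i j l) (beforeOne-++-1∷ A B 1<A) (afterOne-++-1∷ A B 1<A) ⟩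
    splitStats A B i j l ∎
    where open SplitAtOne s

splitCount-suc : ∀ n i j l → splitCount (suc n) i j l ≡ insertMax n (splitCount n) i j l
splitCount-suc n i j l = begin
  splitCount (suc n) i j l
    ≡⟨ sumMap-perms-suc (suc n) (λ w → splitStats (beforeOne w) (afterOne w) i j l) ⟩
  sumMap (λ σ → sumMap (λ w → splitStats (beforeOne w) (afterOne w) i j l) (insertions (suc (suc n)) σ)) (perms (suc n))
    ≡⟨ sumMap-cong (perms (suc n)) step ⟩
  sumMap (λ σ → insertMax n (splitStats (beforeOne σ) (afterOne σ)) i j l) (perms (suc n))
    ≡⟨ sumMap-insertMax (perms (suc n)) n (λ σ → splitStats (beforeOne σ) (afterOne σ)) i j l ⟩
  insertMax n (splitCount n) i j l ∎
  where
  step : ∀ σ → σ ∈ perms (suc n) →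
    sumMap (λ w → splitStats (beforeOne w) (afterOne w) i j l) (insertions (suc (suc n)) σ) ≡
    insertMax n (splitStats (beforeOne σ) (afterOne σ)) i j l
  step σ σ∈ = begin
    sumMap (λ w → splitStats (beforeOne w) (afterOne w) i j l) (insertions (suc (suc n)) σ)
      ≡⟨ cong (λ τ → sumMap (λ w → splitStats (beforeOne w) (afterOne w) i j l) (insertions (suc (suc n)) τ)) σ≡A++1∷B ⟩
    sumMap (λ w → splitStats (beforeOne w) (afterOne w) i j l) (insertions (suc (suc n)) (A ++ 1 ∷ B))
      ≡⟨ insertions-splitStats n (suc (suc n)) (s≤s (s≤s z≤n)) A B 1<A 1<B A<2+n B<2+n |A|+|B|≡n i j l ⟩
    insertMax n (splitStats A B) i j l
      ≡⟨ insertMax-cong n (λ a b c → sym (splitStats-of-split n σ split a b c)) i j l ⟩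
    insertMax n (splitStats (beforeOne σ) (afterOne σ)) i j l ∎
    where
    split = splitAtOne n σ σ∈
    open SplitAtOne split

leftPeaks-count≡sum-splitCount : ∀ n k → countPerms leftPeaks (suc n) k ≡ sumToℕ n (λ i → sumToℕ k (λ j → splitCount n i j (k ∸ j)))
leftPeaks-count≡sum-splitCount n k = begin
  sumMap (λ σ → δ (leftPeaks σ) k) (perms (suc n))
    ≡⟨ sumMap-cong (perms (suc n)) per-permutation ⟩
  sumMap (λ σ → sumToℕ n (λ i → sumToℕ k (λ j → splitStats (beforeOne σ) (afterOne σ) i j (k ∸ j)))) (perms (suc n))
    ≡⟨ sumMap-sumToℕ (perms (suc n)) n _ ⟩
  sumToℕ n (λ i → sumMap (λ σ → sumToℕ k (λ j → splitStats (beforeOne σ) (afterOne σ) i j (k ∸ j))) (perms (suc n)))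
    ≡⟨ sumToℕ-cong n (λ i _ → sumMap-sumToℕ (perms (suc n)) k _) ⟩
  sumToℕ n (λ i → sumToℕ k (λ j → splitCount n i j (k ∸ j))) ∎
  where
  per-permutation : ∀ σ → σ ∈ perms (suc n) →
    δ (leftPeaks σ) k ≡ sumToℕ n (λ i → sumToℕ k (λ j → splitStats (beforeOne σ) (afterOne σ) i j (k ∸ j)))
  per-permutation σ σ∈ = sym (begin
    sumToℕ n (λ i → sumToℕ k (λ j → splitStats (beforeOne σ) (afterOne σ) i j (k ∸ j)))
      ≡⟨ sumToℕ-cong n (λ i _ → sumToℕ-cong k (λ j _ → splitStats-of-split n σ split i j (k ∸ j))) ⟩
    sumToℕ n (λ i → sumToℕ k (λ j → δ (length A) i * (δ (exteriorPeaks A) j * δ (leftPeaks B) (k ∸ j))))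
      ≡⟨ sumToℕ-cong n (λ i _ → sym (*-distribˡ-sumToℕ k (δ (length A) i) _)) ⟩
    sumToℕ n (λ i → δ (length A) i * sumToℕ k (λ j → δ (exteriorPeaks A) j * δ (leftPeaks B) (k ∸ j)))
      ≡⟨ sumToℕ-δ n (length A) _ (subst (length A ≤_) |A|+|B|≡n (m≤m+n _ _)) ⟩
    sumToℕ k (λ j → δ (exteriorPeaks A) j * δ (leftPeaks B) (k ∸ j))
      ≡⟨ sumToℕ-δ-antidiagonal k (exteriorPeaks A) (leftPeaks B) ⟩
    δ (exteriorPeaks A + leftPeaks B) k
      ≡⟨ cong (λ z → δ z k) (sym (trans (cong leftPeaks σ≡A++1∷B) (leftPeaks-++-1∷ A B 1<A 1<B))) ⟩
    δ (leftPeaks σ) k ∎)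
    where
    split = splitAtOne n σ σ∈
    open SplitAtOne split

splitProduct : ℕ → ℕ → ℕ → ℕ → ℕ
splitProduct n i j l = (n C i) * (countPerms exteriorPeaks i j * countPerms leftPeaks (n ∸ i) l)

private
  W′ = countPerms exteriorPeaks
  L′ = countPerms leftPeaks

  product-into-A : ∀ n i j l → (n C i) * (W′ (suc i) j * L′ (n ∸ i) l) ≡ exteriorStep i (λ s → splitProduct n i s l) j
  product-into-A n i j l = begin
    (n C i) * (W′ (suc i) j * L′ (n ∸ i) l)
      ≡⟨ cong (λ w → (n C i) * (w * L′ (n ∸ i) l)) (exteriorPeaks-recurrence i j) ⟩
    (n C i) * (exteriorStep i (W′ i) j * L′ (n ∸ i) l)
      ≡⟨ cong ((n C i) *_) (trans (*-comm _ (L′ (n ∸ i) l))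
           (*-distribˡ-insertionStep (2 *_) (λ s → suc i ∸ 2 * s) (W′ i) j (L′ (n ∸ i) l))) ⟩
    (n C i) * exteriorStep i (λ s → L′ (n ∸ i) l * W′ i s) j
      ≡⟨ *-distribˡ-insertionStep (2 *_) (λ s → suc i ∸ 2 * s) _ j (n C i) ⟩
    exteriorStep i (λ s → (n C i) * (L′ (n ∸ i) l * W′ i s)) j
      ≡⟨ insertionStep-cong (2 *_) (λ s → suc i ∸ 2 * s) j (λ s → cong ((n C i) *_) (*-comm (L′ (n ∸ i) l) (W′ i s))) ⟩
    exteriorStep i (λ s → splitProduct n i s l) j ∎

  product-into-B : ∀ n i j l → (n C suc i) * (W′ (suc i) j * L′ (n ∸ i) l) ≡ leftStep (n ∸ suc i) (splitProduct n (suc i) j) l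
  product-into-B n i j l with suc i ≤? n
  ... | yes i<n = begin
    (n C suc i) * (W′ (suc i) j * L′ (n ∸ i) l)
      ≡⟨ cong (λ k → (n C suc i) * (W′ (suc i) j * L′ k l)) (+-∸-assoc 1 i<n) ⟩
    (n C suc i) * (W′ (suc i) j * L′ (suc (n ∸ suc i)) l)
      ≡⟨ cong (λ z → (n C suc i) * (W′ (suc i) j * z)) (leftPeaks-recurrence (n ∸ suc i) l) ⟩
    (n C suc i) * (W′ (suc i) j * leftStep (n ∸ suc i) (L′ (n ∸ suc i)) l)
      ≡⟨ cong ((n C suc i) *_) (*-distribˡ-insertionStep (λ t → suc (2 * t)) (λ s → n ∸ suc i ∸ 2 * s) _ l (W′ (suc i) j)) ⟩
    (n C suc i) * leftStep (n ∸ suc i) (λ s → W′ (suc i) j * L′ (n ∸ suc i) s) l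
      ≡⟨ *-distribˡ-insertionStep (λ t → suc (2 * t)) (λ s → n ∸ suc i ∸ 2 * s) _ l (n C suc i) ⟩
    leftStep (n ∸ suc i) (splitProduct n (suc i) j) l ∎
  ... | no i≮n = begin
    (n C suc i) * (W′ (suc i) j * L′ (n ∸ i) l)
      ≡⟨ cong (_* (W′ (suc i) j * L′ (n ∸ i) l)) nC[1+i]≡0 ⟩
    0
      ≡⟨ *-distribˡ-insertionStep (λ t → suc (2 * t)) (λ s → n ∸ suc i ∸ 2 * s) (λ s → W′ (suc i) j * L′ (n ∸ suc i) s) l 0 ⟩
    leftStep (n ∸ suc i) (λ s → 0 * (W′ (suc i) j * L′ (n ∸ suc i) s)) l
      ≡⟨ insertionStep-cong (λ t → suc (2 * t)) (λ s → n ∸ suc i ∸ 2 * s) l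
           (λ s → cong (_* (W′ (suc i) j * L′ (n ∸ suc i) s)) (sym nC[1+i]≡0)) ⟩
    leftStep (n ∸ suc i) (splitProduct n (suc i) j) l ∎
    where
    nC[1+i]≡0 : n C suc i ≡ 0
    nC[1+i]≡0 = k>n⇒nCk≡0 (≰⇒> i≮n)

splitProduct-suc : ∀ n i j l → splitProduct (suc n) i j l ≡ insertMax n (splitProduct n) i j l
splitProduct-suc n zero j l = begin
  1 * (W′ 0 j * L′ (suc n) l)
    ≡⟨ cong (λ z → 1 * (W′ 0 j * z)) (leftPeaks-recurrence n l) ⟩
  1 * (W′ 0 j * leftStep n (L′ n) l)
    ≡⟨ cong (1 *_) (*-distribˡ-insertionStep (λ t → suc (2 * t)) (λ s → n ∸ 2 * s) (L′ n) l (W′ 0 j)) ⟩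
  1 * leftStep n (λ s → W′ 0 j * L′ n s) l
    ≡⟨ *-distribˡ-insertionStep (λ t → suc (2 * t)) (λ s → n ∸ 2 * s) _ l 1 ⟩
  insertMax n (splitProduct n) zero j l ∎
splitProduct-suc n (suc i) j l = begin
  (suc n C suc i) * (W′ (suc i) j * L′ (n ∸ i) l)
    ≡⟨ cong (_* (W′ (suc i) j * L′ (n ∸ i) l)) (sym (nCk+nC[k+1]≡[n+1]C[k+1] n i)) ⟩
  ((n C i) + (n C suc i)) * (W′ (suc i) j * L′ (n ∸ i) l)
    ≡⟨ *-distribʳ-+ _ (n C i) (n C suc i) ⟩
  (n C i) * (W′ (suc i) j * L′ (n ∸ i) l) + (n C suc i) * (W′ (suc i) j * L′ (n ∸ i) l)
    ≡⟨ cong₂ _+_ (product-into-A n i j l) (product-into-B n i j l) ⟩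
  insertMax n (splitProduct n) (suc i) j l ∎

splitCount≡splitProduct : ∀ n i j l → splitCount n i j l ≡ splitProduct n i j l
splitCount≡splitProduct zero    zero    j l =
  trans (+-identityʳ _) (cong (1 *_) (sym (cong₂ _*_ (+-identityʳ (δ 0 j)) (+-identityʳ (δ 0 l)))))
splitCount≡splitProduct zero    (suc i) j l = refl
splitCount≡splitProduct (suc n) i j l = begin
  splitCount (suc n) i j l               ≡⟨ splitCount-suc n i j l ⟩
  insertMax n (splitCount n) i j l       ≡⟨ insertMax-cong n (splitCount≡splitProduct n) i j l ⟩
  insertMax n (splitProduct n) i j l     ≡⟨ sym (splitProduct-suc n i j l) ⟩
  splitProduct (suc n) i j l             ∎

Wcoef≡countPerms : ∀ i j → Wcoef i j ≡ countPerms exteriorPeaks i j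
Wcoef≡countPerms zero    zero    = refl
Wcoef≡countPerms zero    (suc j) = refl
Wcoef≡countPerms (suc i) j       = length-filterᵇ _ (perms (suc i))

Lcoef≡countPerms : ∀ i l → Lcoef i l ≡ countPerms leftPeaks i l
Lcoef≡countPerms zero    zero    = refl
Lcoef≡countPerms zero    (suc l) = refl
Lcoef≡countPerms (suc i) l       = length-filterᵇ _ (perms (suc i))

∂Lcoef≡Wcoef⊙Lcoef : ∀ n k → ∂ Lcoef n k ≡ (Wcoef ⊙ Lcoef) n k
∂Lcoef≡Wcoef⊙Lcoef n k = begin
  Lcoef (suc n) k
    ≡⟨ Lcoef≡countPerms (suc n) k ⟩
  countPerms leftPeaks (suc n) k
    ≡⟨ leftPeaks-count≡sum-splitCount n k ⟩
  sumToℕ n (λ i → sumToℕ k (λ j → splitCount n i j (k ∸ j)))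
    ≡⟨ sumToℕ-cong n (λ i _ → trans (sumToℕ-cong k (λ j _ → splitCount≡splitProduct n i j (k ∸ j)))
                                    (sym (*-distribˡ-sumToℕ k (n C i) _))) ⟩
  sumToℕ n (λ i → (n C i) * sumToℕ k (λ j → countPerms exteriorPeaks i j * countPerms leftPeaks (n ∸ i) (k ∸ j)))
    ≡⟨ sumToℕ-cong n (λ i _ → cong ((n C i) *_) (sumToℕ-cong k (λ j _ →
         sym (cong₂ _*_ (Wcoef≡countPerms i j) (Lcoef≡countPerms (n ∸ i) (k ∸ j)))))) ⟩
  (Wcoef ⊙ Lcoef) n k ∎

theorem2p8 : (n k : ℕ) → Lgf n k ≡ expS Wgf n k
theorem2p8 = egf≡expS Wgf (∫ Wcoef) Lcoef Wgf≡egf (λ _ → refl) Lcoef₀ ∂Lcoef≡Wcoef⊙Lcoef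
  where
  Wgf≡egf : ∀ n k → Wgf n k ≡ egf (∫ Wcoef) n k
  Wgf≡egf zero    k = sym (0/n≡0 1)
  Wgf≡egf (suc n) k = refl
  Lcoef₀ : ∀ k → Lcoef 0 k ≡ 𝟏 0 k
  Lcoef₀ zero    = refl
  Lcoef₀ (suc k) = refl
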